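{- Let $M$ be a maximal independent set of chambers of $\mathrm{PG}(3,q)$. (a) Every incident line-plane pair $(\ell,\pi)$ has $M$-weight $0$, $1$ or $q+1$. If it has weight $q+1$, then every chamber $(Q,h,\tau)\in M$ satisfies $h\cap\ell\neq\emptyset$ or $Q\in\pi$. (b) Every incident point-line pair $(P,\ell)$ has $M$-weight $0$, $1$ or $q+1$. If it has weight $q+1$, then every chamber $(Q,h,\tau)\in M$ satisfies $h\cap\ell\neq\emptyset$ or $P\in\tau$.
   Context: $\mathrm{PG}(3,q)$ is the projective $3$-space over the field with $q$ elements. A chamber is a triple $(P,\ell,\pi)$ of a point, a line and a plane with $P\in\ell\subseteq\pi$. Two chambers $(P_1,\ell_1,\pi_1)$, $(P_2,\ell_2,\pi_2)$ are opposite if $P_1\notin\pi_2$, $P_2\notin\pi_1$ and $\ell_1,\ell_2$ are skew. An independent set is a set of pairwise non-opposite chambers; it is maximal if not properly contained in another independent set. The $M$-weight of an incident line-plane pair $(\ell,\pi)$ (resp. point-line pair $(P,\ell)$) is the number of chambers of $M$ containing both $\ell$ and $\pi$ (resp. $P$ and $\ell$). -}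

module Defs where

open import Data.Nat using (ℕ; zero; suc; _<_)
open import Data.Fin using (Fin; zero; suc) renaming (_<_ to _<ᶠ_)
open import Data.Bool using (Bool; true; false)
open import Data.List using (List; []; _∷_; [_]; map; concatMap; length; filterᵇ)
open import Data.List.Membership.Propositional using (_∈_)
open import Data.List.Relation.Unary.Unique.Propositional using (Unique)
open import Data.Vec using (Vec; []; _∷_; lookup; zipWith; foldr)
import Data.Vec as V
open import Data.Product using (Σ; ∃; _×_; _,_)
open import Data.Sum using (_⊎_)
open import Relation.Binary.PropositionalEquality using (_≡_; _≢_)
open import Relation.Nullary using (¬_; Dec)
open import Algebra.Structures using (IsCommutativeRing)

record FiniteField : Set₁ where
  field
    Carrier : Set
    _+_ _*_ : Carrier → Carrier → Carrier
    -_      : Carrier → Carrier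
    0# 1#   : Carrier
    isCommutativeRing : IsCommutativeRing _≡_ _+_ _*_ -_ 0# 1#
    0≢1     : 0# ≢ 1#
    inverse : ∀ x → x ≢ 0# → Σ Carrier (λ y → (x * y) ≡ 1#)
    _≟_     : (x y : Carrier) → Dec (x ≡ y)
    elements : List Carrier
    complete : ∀ x → x ∈ elements
    unique   : Unique elements

  q : ℕ
  q = length elements

module PG3 (F : FiniteField) where
  open FiniteField F

  V4 : Set
  V4 = Vec Carrier 4

  allVecs : (n : ℕ) → List (Vec Carrier n)
  allVecs zero = [ [] ]
  allVecs (suc n) = concatMap (λ x → map (x ∷_) (allVecs n)) elements

  _·_ : Carrier → V4 → V4
  a · v = V.map (a *_) v

  _⊕_ : V4 → V4 → V4
  _⊕_ = zipWith _+_

  dot : V4 → V4 → Carrier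
  dot u v = foldr _ _+_ 0# (zipWith _*_ u v)

  LeadAt : ∀ {n} → Vec Carrier n → Fin n → Set
  LeadAt (x ∷ xs) zero    = x ≡ 1#
  LeadAt (x ∷ xs) (suc i) = (x ≡ 0#) × LeadAt xs i

  -- canonical representative of a 1-dim subspace (nonzero, first nonzero entry = 1)
  Normalized : V4 → Set
  Normalized v = Σ (Fin 4) (LeadAt v)

  -- Planes: normalized dual vectors w,
  -- the plane being {x : w·x = 0}.  Lines: 2×4 matrices (u,v) in reduced row
  -- echelon form of rank 2 (canonical basis of the 2-dim subspace).
  IsPoint : V4 → Set
  IsPoint = Normalized

  IsPlane : V4 → Set
  IsPlane = Normalized

  Line : Set
  Line = V4 × V4

  IsLine : Line → Set
  IsLine (u , v) = Σ (Fin 4) λ i → Σ (Fin 4) λ j →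
    (i <ᶠ j) × LeadAt u i × LeadAt v j × (lookup u j ≡ 0#)

  PointOnLine : V4 → Line → Set
  PointOnLine P (u , v) = Σ Carrier λ a → Σ Carrier λ b → P ≡ ((a · u) ⊕ (b · v))

  PointOnPlane : V4 → V4 → Set
  PointOnPlane P π = dot π P ≡ 0#

  LineInPlane : Line → V4 → Set
  LineInPlane (u , v) π = (dot π u ≡ 0#) × (dot π v ≡ 0#)

  Meet : Line → Line → Set
  Meet ℓ h = Σ V4 λ P → IsPoint P × PointOnLine P ℓ × PointOnLine P h

  Skew : Line → Line → Set
  Skew ℓ h = ¬ Meet ℓ h

  Triple : Set
  Triple = V4 × Line × V4

  IsChamber : Triple → Set
  IsChamber (P , ℓ , π) = IsPoint P × IsLine ℓ × IsPlane π ×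
    PointOnLine P ℓ × LineInPlane ℓ π

  Opposite : Triple → Triple → Set
  Opposite (P₁ , ℓ₁ , π₁) (P₂ , ℓ₂ , π₂) =
    ¬ PointOnPlane P₁ π₂ × ¬ PointOnPlane P₂ π₁ × Skew ℓ₁ ℓ₂

  SetOfChambers : (Triple → Bool) → Set
  SetOfChambers M = ∀ c → M c ≡ true → IsChamber c

  Independent : (Triple → Bool) → Set
  Independent M = SetOfChambers M ×
    (∀ c d → M c ≡ true → M d ≡ true → ¬ Opposite c d)

  _⊆_ : (Triple → Bool) → (Triple → Bool) → Set
  M ⊆ N = ∀ c → M c ≡ true → N c ≡ true

  MaximalIndependent : (Triple → Bool) → Set
  MaximalIndependent M = Independent M ×
    (∀ N → Independent N → M ⊆ N → N ⊆ M)

  weightLP : (Triple → Bool) → Line → V4 → ℕ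
  weightLP M ℓ π = length (filterᵇ (λ P → M (P , ℓ , π)) (allVecs 4))

  weightPL : (Triple → Bool) → V4 → Line → ℕ
  weightPL M P ℓ = length (filterᵇ (λ π → M (P , ℓ , π)) (allVecs 4))

{-# OPTIONS --safe #-}
-- If two chambers of M share their line-plane pair (ℓ, π), every chamber (Q, h, τ) of M has h
-- meeting ℓ or Q ∈ π: otherwise non-opposition puts both points of the pair into τ, so ℓ ⊆ τ, and
-- two lines of the plane τ meet.  Dually, if two chambers share (P, ℓ), every chamber (Q, h, τ) of
-- M has h meeting ℓ or P ∈ τ, since otherwise Q lies on both planes and hence on ℓ.  In either
-- case the chamber (P′, ℓ, π), for any point P′ of ℓ (resp. (P, ℓ, π′), for any plane π′ through
-- ℓ) is opposite to no chamber of M, so maximality puts all q + 1 of them into M.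
--
-- The geometry is done in coordinates: a line (u, v) in echelon form has pivots i, j, and for the
-- remaining coordinates k, m the forms σ k, σ m identify F⁴/ℓ with F², so the incidence facts
-- about ℓ reduce to 2 × 2 determinants.
module Submission where

open import Defs
open import Algebra.Bundles using (CommutativeRing; RawRing)
open import Algebra.Solver.Ring.AlmostCommutativeRing
  using (fromCommutativeRing; _-Raw-AlmostCommutative⟶_)
open import Data.Bool using (Bool; true; false; _∨_; T; T?)
import Data.Bool.Properties as Bool
open import Data.Empty using (⊥-elim)
open import Data.Fin as Fin using (Fin; zero; suc) renaming (_<_ to _<ᶠ_)
import Data.Fin.Properties as Fin
open import Data.Integer as ℤ using (ℤ; +_; -[1+_])
import Data.Integer.Properties as ℤ
open import Data.List as List using (List; []; _∷_)
import Data.List.Properties as List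
open import Data.List.Membership.Propositional using (_∈_; lose)
import Data.List.Membership.Propositional.Properties as ∈
open import Data.List.Membership.Propositional.Properties.WithK using (unique∧set⇒bag)
open import Data.List.Relation.Binary.BagAndSetEquality using (∼bag⇒↭)
open import Data.List.Relation.Binary.Permutation.Propositional.Properties using (↭-length)
open import Data.List.Relation.Unary.All as All using ([]; _∷_)
import Data.List.Relation.Unary.All.Properties as All
open import Data.List.Relation.Unary.AllPairs using ([]; _∷_)
open import Data.List.Relation.Unary.Any as Any using (here; there; satisfied)
open import Data.List.Relation.Unary.Unique.Propositional using (Unique)
import Data.List.Relation.Unary.Unique.Propositional.Properties as Unique
open import Data.Maybe using (Maybe; just; nothing)
import Data.Maybe.Properties as Maybe
open import Data.Nat as ℕ using (ℕ; zero; suc)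
import Data.Nat.Properties as ℕ
open import Data.Product using (Σ; ∃; ∃₂; _×_; _,_; proj₁; proj₂; uncurry)
import Data.Product.Properties as Product
open import Data.Sign as Sign using (Sign)
open import Data.Sum using (_⊎_; inj₁; inj₂; [_,_]′)
open import Data.Vec as V using (Vec; []; _∷_; lookup)
import Data.Vec.Properties as V
open import Data.Vec.Relation.Binary.Pointwise.Extensional using (ext; Pointwise-≡⇒≡)
open import Function.Bundles using (_⇔_; mk⇔; module Equivalence)
open import Relation.Binary.Definitions using (tri<; tri≈; tri>)
open import Relation.Binary.PropositionalEquality as ≡
open import Relation.Nullary using (¬_; Dec; yes; no; does)
open import Relation.Nullary.Decidable using (from-yes; ¬?; _×-dec_; _⊎-dec_; _→-dec_)

-- Integer coefficients: with the ring itself as coefficient ring the solver cannot decide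
-- coefficient equalities such as 1# - 1# ≡ 0# in an abstract field.
module IntegerCoefficientSolver {c ℓ} (R : CommutativeRing c ℓ) where
  open CommutativeRing R hiding (zero; refl; sym; trans; setoid)
  open CommutativeRing R using () renaming (refl to ≈-refl; sym to ≈-sym; trans to ≈-trans; setoid to ≈-setoid)
  open import Algebra.Properties.Semiring.Mult.TCOptimised semiring
    using (×-homo-+; ×1-homo-*; 1+×) renaming (_×_ to _×ₙ_)
  open import Algebra.Properties.Ring ring
    using (-‿involutive; -0#≈0#; -‿distribˡ-*; -‿distribʳ-*; -‿+-comm)
  open import Relation.Binary.Reasoning.Setoid ≈-setoid

  ℤ-rawRing : RawRing _ _
  ℤ-rawRing = record
    { Carrier = ℤ ; _≈_ = _≡_ ; _+_ = ℤ._+_ ; _*_ = ℤ._*_ ; -_ = ℤ.-_ ; 0# = + 0 ; 1# = + 1 }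

  sign⟦_⟧ : Sign → Carrier
  sign⟦ Sign.+ ⟧ = 1#
  sign⟦ Sign.- ⟧ = - 1#

  ⟦_⟧ : ℤ → Carrier
  ⟦ + n ⟧      = n ×ₙ 1#
  ⟦ -[1+ n ] ⟧ = - (suc n ×ₙ 1#)

  ⟦◃⟧ : ∀ s n → ⟦ s ℤ.◃ n ⟧ ≈ sign⟦ s ⟧ * (n ×ₙ 1#)
  ⟦◃⟧ Sign.+ zero    = ≈-sym (zeroʳ _)
  ⟦◃⟧ Sign.- zero    = ≈-sym (zeroʳ _)
  ⟦◃⟧ Sign.+ (suc n) = ≈-sym (*-identityˡ _)
  ⟦◃⟧ Sign.- (suc n) = ≈-trans (-‿cong (≈-sym (*-identityˡ _))) (-‿distribˡ-* _ _)

  ⟦sign*abs⟧ : ∀ i → ⟦ i ⟧ ≈ sign⟦ ℤ.sign i ⟧ * (ℤ.∣ i ∣ ×ₙ 1#)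
  ⟦sign*abs⟧ (+ n)    = ≈-sym (*-identityˡ _)
  ⟦sign*abs⟧ -[1+ n ] = ≈-trans (-‿cong (≈-sym (*-identityˡ _))) (-‿distribˡ-* _ _)

  sign⟦*⟧ : ∀ s t → sign⟦ s Sign.* t ⟧ ≈ sign⟦ s ⟧ * sign⟦ t ⟧
  sign⟦*⟧ Sign.+ Sign.+ = ≈-sym (*-identityˡ _)
  sign⟦*⟧ Sign.+ Sign.- = ≈-sym (*-identityˡ _)
  sign⟦*⟧ Sign.- Sign.+ = ≈-sym (*-identityʳ _)
  sign⟦*⟧ Sign.- Sign.- = begin
    1#            ≈⟨ ≈-sym (-‿involutive 1#) ⟩
    - (- 1#)      ≈⟨ -‿cong (≈-sym (*-identityʳ _)) ⟩
    - (- 1# * 1#) ≈⟨ -‿distribʳ-* _ _ ⟩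
    - 1# * - 1#   ∎

  interchange : ∀ a b x y → (a * b) * (x * y) ≈ (a * x) * (b * y)
  interchange a b x y = begin
    (a * b) * (x * y) ≈⟨ *-assoc _ _ _ ⟩
    a * (b * (x * y)) ≈⟨ *-congˡ (≈-sym (*-assoc _ _ _)) ⟩
    a * ((b * x) * y) ≈⟨ *-congˡ (*-congʳ (*-comm _ _)) ⟩
    a * ((x * b) * y) ≈⟨ *-congˡ (*-assoc _ _ _) ⟩
    a * (x * (b * y)) ≈⟨ ≈-sym (*-assoc _ _ _) ⟩
    (a * x) * (b * y) ∎

  ⟦*⟧ : ∀ i j → ⟦ i ℤ.* j ⟧ ≈ ⟦ i ⟧ * ⟦ j ⟧
  ⟦*⟧ i j = begin
    ⟦ i ℤ.* j ⟧
      ≈⟨ ⟦◃⟧ (ℤ.sign i Sign.* ℤ.sign j) (ℤ.∣ i ∣ ℕ.* ℤ.∣ j ∣) ⟩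
    sign⟦ ℤ.sign i Sign.* ℤ.sign j ⟧ * ((ℤ.∣ i ∣ ℕ.* ℤ.∣ j ∣) ×ₙ 1#)
      ≈⟨ *-cong (sign⟦*⟧ (ℤ.sign i) (ℤ.sign j)) (×1-homo-* ℤ.∣ i ∣ ℤ.∣ j ∣) ⟩
    (sign⟦ ℤ.sign i ⟧ * sign⟦ ℤ.sign j ⟧) * ((ℤ.∣ i ∣ ×ₙ 1#) * (ℤ.∣ j ∣ ×ₙ 1#))
      ≈⟨ interchange _ _ _ _ ⟩
    (sign⟦ ℤ.sign i ⟧ * (ℤ.∣ i ∣ ×ₙ 1#)) * (sign⟦ ℤ.sign j ⟧ * (ℤ.∣ j ∣ ×ₙ 1#))
      ≈⟨ ≈-sym (*-cong (⟦sign*abs⟧ i) (⟦sign*abs⟧ j)) ⟩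
    ⟦ i ⟧ * ⟦ j ⟧ ∎

  ⟦⊖⟧ : ∀ m n → ⟦ m ℤ.⊖ n ⟧ ≈ (m ×ₙ 1#) - (n ×ₙ 1#)
  ⟦⊖⟧ m zero = begin
    ⟦ m ℤ.⊖ zero ⟧       ≡⟨ ≡.cong ⟦_⟧ (ℤ.⊖-≥ {m} {zero} ℕ.z≤n) ⟩
    m ×ₙ 1#            ≈⟨ ≈-sym (+-identityʳ _) ⟩
    m ×ₙ 1# + 0#       ≈⟨ +-congˡ (≈-sym -0#≈0#) ⟩
    m ×ₙ 1# + - 0#     ∎
  ⟦⊖⟧ zero (suc n) = begin
    ⟦ zero ℤ.⊖ suc n ⟧      ≡⟨ ≡.cong ⟦_⟧ (ℤ.⊖-< {zero} {suc n} (ℕ.s≤s ℕ.z≤n)) ⟩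
    - (suc n ×ₙ 1#)       ≈⟨ ≈-sym (+-identityˡ _) ⟩
    0# + - (suc n ×ₙ 1#)  ∎
  ⟦⊖⟧ (suc m) (suc n) = begin
    ⟦ suc m ℤ.⊖ suc n ⟧                       ≡⟨ ≡.cong ⟦_⟧ (ℤ.[1+m]⊖[1+n]≡m⊖n m n) ⟩
    ⟦ m ℤ.⊖ n ⟧                               ≈⟨ ⟦⊖⟧ m n ⟩
    m′ - n′                                 ≈⟨ ≈-sym (+-identityˡ _) ⟩
    0# + (m′ - n′)                          ≈⟨ +-congʳ (≈-sym (-‿inverseʳ 1#)) ⟩
    (1# - 1#) + (m′ - n′)                   ≈⟨ interchange⁺ ⟩
    (1# + m′) + (- 1# + - n′)               ≈⟨ +-congˡ (-‿+-comm _ _) ⟩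
    (1# + m′) - (1# + n′)                   ≈⟨ ≈-sym (+-cong (1+× m 1#) (-‿cong (1+× n 1#))) ⟩
    suc m ×ₙ 1# - suc n ×ₙ 1#               ∎
    where
    m′ = m ×ₙ 1#
    n′ = n ×ₙ 1#
    interchange⁺ : (1# - 1#) + (m′ - n′) ≈ (1# + m′) + (- 1# + - n′)
    interchange⁺ = begin
      (1# + - 1#) + (m′ + - n′) ≈⟨ +-assoc _ _ _ ⟩
      1# + (- 1# + (m′ + - n′)) ≈⟨ +-congˡ (≈-sym (+-assoc _ _ _)) ⟩
      1# + ((- 1# + m′) + - n′) ≈⟨ +-congˡ (+-congʳ (+-comm _ _)) ⟩
      1# + ((m′ + - 1#) + - n′) ≈⟨ +-congˡ (+-assoc _ _ _) ⟩
      1# + (m′ + (- 1# + - n′)) ≈⟨ ≈-sym (+-assoc _ _ _) ⟩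
      (1# + m′) + (- 1# + - n′) ∎

  ⟦+⟧ : ∀ i j → ⟦ i ℤ.+ j ⟧ ≈ ⟦ i ⟧ + ⟦ j ⟧
  ⟦+⟧ (+ m)    (+ n)    = ×-homo-+ 1# m n
  ⟦+⟧ (+ m)    -[1+ n ] = ⟦⊖⟧ m (suc n)
  ⟦+⟧ -[1+ m ] (+ n)    = ≈-trans (⟦⊖⟧ n (suc m)) (+-comm _ _)
  ⟦+⟧ -[1+ m ] -[1+ n ] = begin
    - (suc (suc (m ℕ.+ n)) ×ₙ 1#)       ≡⟨ ≡.cong (λ k → - (suc k ×ₙ 1#)) (≡.sym (ℕ.+-suc m n)) ⟩
    - ((suc m ℕ.+ suc n) ×ₙ 1#)         ≈⟨ -‿cong (×-homo-+ 1# (suc m) (suc n)) ⟩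
    - (suc m ×ₙ 1# + suc n ×ₙ 1#)       ≈⟨ ≈-sym (-‿+-comm _ _) ⟩
    - (suc m ×ₙ 1#) + - (suc n ×ₙ 1#)   ∎

  ⟦-⟧ : ∀ i → ⟦ ℤ.- i ⟧ ≈ - ⟦ i ⟧
  ⟦-⟧ (+ zero)  = ≈-sym -0#≈0#
  ⟦-⟧ (+ suc n) = ≈-refl
  ⟦-⟧ -[1+ n ]  = ≈-sym (-‿involutive _)

  ℤ⟶R : ℤ-rawRing -Raw-AlmostCommutative⟶ fromCommutativeRing R
  ℤ⟶R = record
    { ⟦_⟧ = ⟦_⟧ ; +-homo = ⟦+⟧ ; *-homo = ⟦*⟧ ; -‿homo = ⟦-⟧ ; 0-homo = ≈-refl ; 1-homo = ≈-refl }

  ⟦⟧-≟ : ∀ i j → Maybe (⟦ i ⟧ ≈ ⟦ j ⟧)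
  ⟦⟧-≟ i j with i ℤ.≟ j
  ... | yes ≡.refl = just ≈-refl
  ... | no _       = nothing

  open import Algebra.Solver.Ring ℤ-rawRing (fromCommutativeRing R) ℤ⟶R ⟦⟧-≟ public
    using (solve; _:+_; _:*_; :-_; _:-_; con; _:=_)

module FieldArithmetic (F : FiniteField) where
  open FiniteField F public using (Carrier; _≟_; elements; complete; unique; q; 0≢1)

  commutativeRing : CommutativeRing _ _
  commutativeRing = record { isCommutativeRing = FiniteField.isCommutativeRing F }

  open CommutativeRing commutativeRing public
    using (_+_; _*_; -_; _-_; 0#; 1#; *-comm; *-assoc; zeroˡ; zeroʳ; *-identityˡ; *-identityʳ)
  open IntegerCoefficientSolver commutativeRing public

  1≢0 : 1# ≢ 0#
  1≢0 = ≢-sym 0≢1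

  _⁻¹⟨_⟩ : (x : Carrier) → x ≢ 0# → Carrier
  x ⁻¹⟨ x≢0 ⟩ = proj₁ (FiniteField.inverse F x x≢0)

  *-inverseʳ : ∀ x (x≢0 : x ≢ 0#) → x * x ⁻¹⟨ x≢0 ⟩ ≡ 1#
  *-inverseʳ x x≢0 = proj₂ (FiniteField.inverse F x x≢0)

  *-inverseˡ : ∀ x (x≢0 : x ≢ 0#) → x ⁻¹⟨ x≢0 ⟩ * x ≡ 1#
  *-inverseˡ x x≢0 = trans (*-comm _ x) (*-inverseʳ x x≢0)

  *-cancelˡ : ∀ {x y z} → x ≢ 0# → x * y ≡ x * z → y ≡ z
  *-cancelˡ {x} {y} {z} x≢0 eq = begin
    y                  ≡⟨ sym (*-identityˡ y) ⟩
    1# * y             ≡⟨ cong (_* y) (sym x·x⁻¹≡1) ⟩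
    (x * x⁻¹) * y      ≡⟨ solve 3 (λ x i y → (x :* i) :* y := i :* (x :* y)) refl x x⁻¹ y ⟩
    x⁻¹ * (x * y)      ≡⟨ cong (x⁻¹ *_) eq ⟩
    x⁻¹ * (x * z)      ≡⟨ solve 3 (λ x i z → i :* (x :* z) := (x :* i) :* z) refl x x⁻¹ z ⟩
    (x * x⁻¹) * z      ≡⟨ cong (_* z) x·x⁻¹≡1 ⟩
    1# * z             ≡⟨ *-identityˡ z ⟩
    z                  ∎
    where
    open ≡-Reasoning
    x⁻¹ = x ⁻¹⟨ x≢0 ⟩
    x·x⁻¹≡1 = *-inverseʳ x x≢0

  x*y≡0⇒y≡0 : ∀ {x y} → x ≢ 0# → x * y ≡ 0# → y ≡ 0#
  x*y≡0⇒y≡0 {x} x≢0 xy≡0 = *-cancelˡ x≢0 (trans xy≡0 (sym (zeroʳ x)))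

  x*y≡0⇒x≡0 : ∀ {x y} → y ≢ 0# → x * y ≡ 0# → x ≡ 0#
  x*y≡0⇒x≡0 {x} {y} y≢0 xy≡0 = x*y≡0⇒y≡0 y≢0 (trans (*-comm y x) xy≡0)

  x-y≡0⇒x≡y : ∀ {x y} → x - y ≡ 0# → x ≡ y
  x-y≡0⇒x≡y {x} {y} x-y≡0 = begin
    x             ≡⟨ solve 2 (λ x y → x := (x :- y) :+ y) refl x y ⟩
    (x - y) + y   ≡⟨ cong (_+ y) x-y≡0 ⟩
    0# + y        ≡⟨ solve 1 (λ y → con (+ 0) :+ y := y) refl y ⟩
    y             ∎
    where open ≡-Reasoning

  x-x≡0 : ∀ x → x - x ≡ 0#
  x-x≡0 = solve 1 (λ x → x :- x := con (+ 0)) refl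

  det₂ : Carrier → Carrier → Carrier → Carrier → Carrier
  det₂ a b c d = a * d - b * c

  det₂-annihilates : ∀ {a b c d x y} → a * x + b * y ≡ 0# → c * x + d * y ≡ 0# →
                     det₂ a b c d * x ≡ 0# × det₂ a b c d * y ≡ 0#
  det₂-annihilates {a} {b} {c} {d} {x} {y} e₁ e₂ =
    (begin
      det₂ a b c d * x                    ≡⟨ solve 6 (λ a b c d x y → (a :* d :- b :* c) :* x
                                               := d :* (a :* x :+ b :* y) :- b :* (c :* x :+ d :* y)) refl a b c d x y ⟩
      d * (a * x + b * y) - b * (c * x + d * y)  ≡⟨ cong₂ (λ s t → d * s - b * t) e₁ e₂ ⟩
      d * 0# - b * 0#                     ≡⟨ solve 2 (λ b d → d :* con (+ 0) :- b :* con (+ 0) := con (+ 0)) refl b d ⟩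
      0#                                  ∎) ,
    (begin
      det₂ a b c d * y                    ≡⟨ solve 6 (λ a b c d x y → (a :* d :- b :* c) :* y
                                               := a :* (c :* x :+ d :* y) :- c :* (a :* x :+ b :* y)) refl a b c d x y ⟩
      a * (c * x + d * y) - c * (a * x + b * y)  ≡⟨ cong₂ (λ s t → a * s - c * t) e₂ e₁ ⟩
      a * 0# - c * 0#                     ≡⟨ solve 2 (λ a c → a :* con (+ 0) :- c :* con (+ 0) := con (+ 0)) refl a c ⟩
      0#                                  ∎)
    where open ≡-Reasoning

  ⁻¹-≢0 : ∀ x (x≢0 : x ≢ 0#) → x ⁻¹⟨ x≢0 ⟩ ≢ 0#
  ⁻¹-≢0 x x≢0 x⁻¹≡0 = 1≢0 (trans (sym (*-inverseʳ x x≢0)) (trans (cong (x *_) x⁻¹≡0) (zeroʳ x)))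

module Coordinates (F : FiniteField) where
  open FieldArithmetic F
  open PG3 F

  ≗⇒≡ : ∀ {n} {x y : Vec Carrier n} → (∀ t → lookup x t ≡ lookup y t) → x ≡ y
  ≗⇒≡ x≗y = Pointwise-≡⇒≡ (ext x≗y)

  lookup-⊕ : ∀ x y t → lookup (x ⊕ y) t ≡ lookup x t + lookup y t
  lookup-⊕ x y t = V.lookup-zipWith _+_ t x y

  lookup-· : ∀ a x t → lookup (a · x) t ≡ a * lookup x t
  lookup-· a x t = V.lookup-map t (a *_) x

  lookup-comb : ∀ a x b y t → lookup ((a · x) ⊕ (b · y)) t ≡ a * lookup x t + b * lookup y t
  lookup-comb a x b y t = trans (lookup-⊕ (a · x) (b · y) t) (cong₂ _+_ (lookup-· a x t) (lookup-· b y t))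

  ·-comb : ∀ c a x b y → c · ((a · x) ⊕ (b · y)) ≡ ((c * a) · x) ⊕ ((c * b) · y)
  ·-comb c a x b y = ≗⇒≡ λ t → begin
    lookup (c · ((a · x) ⊕ (b · y))) t       ≡⟨ lookup-· c ((a · x) ⊕ (b · y)) t ⟩
    c * lookup ((a · x) ⊕ (b · y)) t         ≡⟨ cong (c *_) (lookup-comb a x b y t) ⟩
    c * (a * lookup x t + b * lookup y t)
      ≡⟨ solve 5 (λ c a b s t → c :* (a :* s :+ b :* t) := c :* a :* s :+ c :* b :* t) refl c a b _ _ ⟩
    (c * a) * lookup x t + (c * b) * lookup y t  ≡⟨ sym (lookup-comb (c * a) x (c * b) y t) ⟩
    lookup (((c * a) · x) ⊕ ((c * b) · y)) t ∎
    where open ≡-Reasoning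

  _⊖_ : V4 → V4 → V4
  x ⊖ y = (1# · x) ⊕ ((- 1#) · y)

  lookup-⊖ : ∀ x y t → lookup (x ⊖ y) t ≡ lookup x t - lookup y t
  lookup-⊖ x y t = trans (lookup-comb 1# x (- 1#) y t)
    (solve 2 (λ s t → con (+ 1) :* s :+ (:- con (+ 1)) :* t := s :- t) refl (lookup x t) (lookup y t))

  dot-comm : ∀ x y → dot x y ≡ dot y x
  dot-comm (x₀ ∷ x₁ ∷ x₂ ∷ x₃ ∷ []) (y₀ ∷ y₁ ∷ y₂ ∷ y₃ ∷ []) =
    solve 8 (λ x₀ x₁ x₂ x₃ y₀ y₁ y₂ y₃ →
               x₀ :* y₀ :+ (x₁ :* y₁ :+ (x₂ :* y₂ :+ (x₃ :* y₃ :+ con (+ 0))))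
            := y₀ :* x₀ :+ (y₁ :* x₁ :+ (y₂ :* x₂ :+ (y₃ :* x₃ :+ con (+ 0)))))
      refl x₀ x₁ x₂ x₃ y₀ y₁ y₂ y₃

  dot-⊕ʳ : ∀ z x y → dot z (x ⊕ y) ≡ dot z x + dot z y
  dot-⊕ʳ (z₀ ∷ z₁ ∷ z₂ ∷ z₃ ∷ []) (x₀ ∷ x₁ ∷ x₂ ∷ x₃ ∷ []) (y₀ ∷ y₁ ∷ y₂ ∷ y₃ ∷ []) =
    solve 12 (λ z₀ z₁ z₂ z₃ x₀ x₁ x₂ x₃ y₀ y₁ y₂ y₃ →
               z₀ :* (x₀ :+ y₀) :+ (z₁ :* (x₁ :+ y₁) :+ (z₂ :* (x₂ :+ y₂) :+ (z₃ :* (x₃ :+ y₃) :+ con (+ 0))))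
            := (z₀ :* x₀ :+ (z₁ :* x₁ :+ (z₂ :* x₂ :+ (z₃ :* x₃ :+ con (+ 0)))))
                 :+ (z₀ :* y₀ :+ (z₁ :* y₁ :+ (z₂ :* y₂ :+ (z₃ :* y₃ :+ con (+ 0))))))
      refl z₀ z₁ z₂ z₃ x₀ x₁ x₂ x₃ y₀ y₁ y₂ y₃

  dot-·ʳ : ∀ z a x → dot z (a · x) ≡ a * dot z x
  dot-·ʳ (z₀ ∷ z₁ ∷ z₂ ∷ z₃ ∷ []) a (x₀ ∷ x₁ ∷ x₂ ∷ x₃ ∷ []) =
    solve 9 (λ z₀ z₁ z₂ z₃ a x₀ x₁ x₂ x₃ →
               z₀ :* (a :* x₀) :+ (z₁ :* (a :* x₁) :+ (z₂ :* (a :* x₂) :+ (z₃ :* (a :* x₃) :+ con (+ 0))))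
            := a :* (z₀ :* x₀ :+ (z₁ :* x₁ :+ (z₂ :* x₂ :+ (z₃ :* x₃ :+ con (+ 0))))))
      refl z₀ z₁ z₂ z₃ a x₀ x₁ x₂ x₃

  dot-⊕ˡ : ∀ x y z → dot (x ⊕ y) z ≡ dot x z + dot y z
  dot-⊕ˡ x y z = trans (dot-comm (x ⊕ y) z) (trans (dot-⊕ʳ z x y) (cong₂ _+_ (dot-comm z x) (dot-comm z y)))

  dot-·ˡ : ∀ a x z → dot (a · x) z ≡ a * dot x z
  dot-·ˡ a x z = trans (dot-comm (a · x) z) (trans (dot-·ʳ z a x) (cong (a *_) (dot-comm z x)))

  dot-combʳ : ∀ z a x b y → dot z ((a · x) ⊕ (b · y)) ≡ a * dot z x + b * dot z y
  dot-combʳ z a x b y = trans (dot-⊕ʳ z (a · x) (b · y)) (cong₂ _+_ (dot-·ʳ z a x) (dot-·ʳ z b y))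

  dot-combˡ : ∀ a x b y z → dot ((a · x) ⊕ (b · y)) z ≡ a * dot x z + b * dot y z
  dot-combˡ a x b y z = trans (dot-⊕ˡ (a · x) (b · y) z) (cong₂ _+_ (dot-·ˡ a x z) (dot-·ˡ b y z))

  dot-⊖ˡ : ∀ x y z → dot (x ⊖ y) z ≡ dot x z - dot y z
  dot-⊖ˡ x y z = trans (dot-combˡ 1# x (- 1#) y z)
    (solve 2 (λ s t → con (+ 1) :* s :+ (:- con (+ 1)) :* t := s :- t) refl (dot x z) (dot y z))

  dot-single : ∀ x y c → (∀ t → t ≢ c → lookup x t * lookup y t ≡ 0#) → dot x y ≡ lookup x c * lookup y c
  dot-single (x₀ ∷ x₁ ∷ x₂ ∷ x₃ ∷ []) (y₀ ∷ y₁ ∷ y₂ ∷ y₃ ∷ []) zero h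
    rewrite h (suc zero) (λ ()) | h (suc (suc zero)) (λ ()) | h (suc (suc (suc zero))) (λ ()) =
    solve 1 (λ s → s :+ (con (+ 0) :+ (con (+ 0) :+ (con (+ 0) :+ con (+ 0)))) := s) refl (x₀ * y₀)
  dot-single (x₀ ∷ x₁ ∷ x₂ ∷ x₃ ∷ []) (y₀ ∷ y₁ ∷ y₂ ∷ y₃ ∷ []) (suc zero) h
    rewrite h zero (λ ()) | h (suc (suc zero)) (λ ()) | h (suc (suc (suc zero))) (λ ()) =
    solve 1 (λ s → con (+ 0) :+ (s :+ (con (+ 0) :+ (con (+ 0) :+ con (+ 0)))) := s) refl (x₁ * y₁)
  dot-single (x₀ ∷ x₁ ∷ x₂ ∷ x₃ ∷ []) (y₀ ∷ y₁ ∷ y₂ ∷ y₃ ∷ []) (suc (suc zero)) h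
    rewrite h zero (λ ()) | h (suc zero) (λ ()) | h (suc (suc (suc zero))) (λ ()) =
    solve 1 (λ s → con (+ 0) :+ (con (+ 0) :+ (s :+ (con (+ 0) :+ con (+ 0)))) := s) refl (x₂ * y₂)
  dot-single (x₀ ∷ x₁ ∷ x₂ ∷ x₃ ∷ []) (y₀ ∷ y₁ ∷ y₂ ∷ y₃ ∷ []) (suc (suc (suc zero))) h
    rewrite h zero (λ ()) | h (suc zero) (λ ()) | h (suc (suc zero)) (λ ()) =
    solve 1 (λ s → con (+ 0) :+ (con (+ 0) :+ (con (+ 0) :+ (s :+ con (+ 0)))) := s) refl (x₃ * y₃)

  dot-single≡0 : ∀ {z w c} → lookup w c ≡ 1# → (∀ t → t ≢ c → lookup z t * lookup w t ≡ 0#) → dot z w ≡ 0# →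
                 lookup z c ≡ 0#
  dot-single≡0 {z} {w} {c} w꜀≡1 others≡0 zw≡0 = begin
    lookup z c                   ≡⟨ sym (*-identityʳ _) ⟩
    lookup z c * 1#              ≡⟨ cong (lookup z c *_) (sym w꜀≡1) ⟩
    lookup z c * lookup w c      ≡⟨ sym (dot-single z w c others≡0) ⟩
    dot z w                      ≡⟨ zw≡0 ⟩
    0#                           ∎
    where open ≡-Reasoning

  unit : Fin 4 → V4
  unit c = V.replicate 4 0# V.[ c ]≔ 1#

  lookup-unit-≡ : ∀ c → lookup (unit c) c ≡ 1#
  lookup-unit-≡ c = V.lookup∘update c (V.replicate 4 0#) 1#

  lookup-unit-≢ : ∀ {c t} → t ≢ c → lookup (unit c) t ≡ 0#
  lookup-unit-≢ {c} {t} t≢c = trans (V.lookup∘update′ t≢c (V.replicate 4 0#) 1#) (V.lookup-replicate t 0#)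

  dot-unitˡ : ∀ c x → dot (unit c) x ≡ lookup x c
  dot-unitˡ c x = begin
    dot (unit c) x                  ≡⟨ dot-single (unit c) x c (λ t t≢c → trans (cong (_* lookup x t) (lookup-unit-≢ t≢c)) (zeroˡ _)) ⟩
    lookup (unit c) c * lookup x c  ≡⟨ cong (_* lookup x c) (lookup-unit-≡ c) ⟩
    1# * lookup x c                 ≡⟨ *-identityˡ _ ⟩
    lookup x c                      ∎
    where open ≡-Reasoning

  LeadAt⇒≡1 : ∀ {n} {x : Vec Carrier n} {i} → LeadAt x i → lookup x i ≡ 1#
  LeadAt⇒≡1 {x = _ ∷ _} {zero}  x₀≡1       = x₀≡1
  LeadAt⇒≡1 {x = _ ∷ _} {suc i} (_ , lead) = LeadAt⇒≡1 lead

  LeadAt⇒≢0 : ∀ {n} {x : Vec Carrier n} {i} → LeadAt x i → lookup x i ≢ 0#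
  LeadAt⇒≢0 lead xᵢ≡0 = 1≢0 (trans (sym (LeadAt⇒≡1 lead)) xᵢ≡0)

  LeadAt⇒<≡0 : ∀ {n} {x : Vec Carrier n} {i} → LeadAt x i → ∀ {k} → k <ᶠ i → lookup x k ≡ 0#
  LeadAt⇒<≡0 {x = _ ∷ _} {suc i} (x₀≡0 , _)    {zero}  _            = x₀≡0
  LeadAt⇒<≡0 {x = _ ∷ _} {suc i} (_    , lead) {suc k} (ℕ.s≤s k<i) = LeadAt⇒<≡0 lead k<i

  *-LeadAt : ∀ {n} {x : Vec Carrier n} {i} a → LeadAt x i → a * lookup x i ≡ a
  *-LeadAt a lead = trans (cong (a *_) (LeadAt⇒≡1 lead)) (*-identityʳ a)

  LeadAt-proportional⇒≡ : ∀ {n} {x y : Vec Carrier n} {i j a b} → LeadAt x i → LeadAt y j → a ≢ 0# →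
                          (∀ t → a * lookup y t ≡ b * lookup x t) → x ≡ y
  LeadAt-proportional⇒≡ {x = x} {y} {i} {j} {a} {b} lead-x lead-y a≢0 ay≡bx with Fin.<-cmp i j
  ... | tri< i<j _ _ = ⊥-elim (LeadAt⇒≢0 lead-y (x*y≡0⇒y≡0 a≢0 (trans (ay≡bx j) (trans (cong (_* lookup x j) b≡0) (zeroˡ _)))))
    where
    b≡0 : b ≡ 0#
    b≡0 = begin
      b                 ≡⟨ sym (*-LeadAt b lead-x) ⟩
      b * lookup x i    ≡⟨ sym (ay≡bx i) ⟩
      a * lookup y i    ≡⟨ cong (a *_) (LeadAt⇒<≡0 lead-y i<j) ⟩
      a * 0#            ≡⟨ zeroʳ a ⟩
      0#                ∎
      where open ≡-Reasoning
  ... | tri> _ _ j<i = ⊥-elim (a≢0 (begin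
      a                 ≡⟨ sym (*-LeadAt a lead-y) ⟩
      a * lookup y j    ≡⟨ ay≡bx j ⟩
      b * lookup x j    ≡⟨ cong (b *_) (LeadAt⇒<≡0 lead-x j<i) ⟩
      b * 0#            ≡⟨ zeroʳ b ⟩
      0#                ∎))
    where open ≡-Reasoning
  ... | tri≈ _ refl _ = ≗⇒≡ λ t → *-cancelˡ a≢0 (trans (cong (_* lookup x t) a≡b) (sym (ay≡bx t)))
    where
    a≡b : a ≡ b
    a≡b = trans (sym (*-LeadAt a lead-y)) (trans (ay≡bx i) (*-LeadAt b lead-x))

  normalize : ∀ {n} → Vec Carrier n → Vec Carrier n
  normalize []      = []
  normalize (a ∷ x) with a ≟ 0#
  ... | yes _   = 0# ∷ normalize x
  ... | no a≢0 = V.map (a ⁻¹⟨ a≢0 ⟩ *_) (a ∷ x)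

  normalize-spec : ∀ {n} (x : Vec Carrier n) t → lookup x t ≢ 0# →
    Σ Carrier λ c → c ≢ 0# × normalize x ≡ V.map (c *_) x × ∃ (LeadAt (normalize x))
  normalize-spec (a ∷ x) t xₜ≢0 with a ≟ 0#
  normalize-spec (a ∷ x) zero    a≢0 | yes a≡0 = ⊥-elim (a≢0 a≡0)
  normalize-spec (a ∷ x) (suc t) xₜ≢0 | yes a≡0 with normalize-spec x t xₜ≢0
  ... | c , c≢0 , eq , i , lead =
    c , c≢0 , cong₂ _∷_ (sym (trans (cong (c *_) a≡0) (zeroʳ c))) eq , suc i , refl , lead
  normalize-spec (a ∷ x) t xₜ≢0 | no a≢0 = a ⁻¹⟨ a≢0 ⟩ , ⁻¹-≢0 a a≢0 , refl , zero , *-inverseˡ a a≢0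

  record Complement (i j : Fin 4) : Set where
    field
      k m   : Fin 4
      k≢i   : k ≢ i
      k≢j   : k ≢ j
      m≢i   : m ≢ i
      m≢j   : m ≢ j
      k≢m   : k ≢ m
      cover : ∀ t → t ≡ i ⊎ t ≡ j ⊎ t ≡ k ⊎ t ≡ m

  -- Found by exhaustive search; opaque so that later conversion checks never unfold the search.
  opaque
    complement-search : ∀ i j → i ≢ j → ∃₂ λ (k m : Fin 4) →
      k ≢ i × k ≢ j × m ≢ i × m ≢ j × k ≢ m × (∀ t → t ≡ i ⊎ t ≡ j ⊎ t ≡ k ⊎ t ≡ m)
    complement-search = from-yes (Fin.all? {n = 4} λ i → Fin.all? {n = 4} λ j → ¬? (i Fin.≟ j) →-dec
      Fin.any? {n = 4} λ k → Fin.any? {n = 4} λ m →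
        ¬? (k Fin.≟ i) ×-dec ¬? (k Fin.≟ j) ×-dec ¬? (m Fin.≟ i) ×-dec ¬? (m Fin.≟ j) ×-dec ¬? (k Fin.≟ m) ×-dec
        Fin.all? {n = 4} λ t → (t Fin.≟ i) ⊎-dec (t Fin.≟ j) ⊎-dec (t Fin.≟ k) ⊎-dec (t Fin.≟ m))

  complement : ∀ i j → i ≢ j → Complement i j
  complement i j i≢j with complement-search i j i≢j
  ... | k , m , k≢i , k≢j , m≢i , m≢j , k≢m , cover = record
    { k = k ; m = m ; k≢i = k≢i ; k≢j = k≢j ; m≢i = m≢i ; m≢j = m≢j ; k≢m = k≢m ; cover = cover }

module Spans (F : FiniteField) where
  open FieldArithmetic F
  open Coordinates F
  open PG3 F

  record Pivots (w₁ w₂ : V4) : Set where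
    field
      i j    : Fin 4
      i≢j    : i ≢ j
      w₁ᵢ≡1 : lookup w₁ i ≡ 1#
      w₁ⱼ≡0 : lookup w₁ j ≡ 0#
      w₂ᵢ≡0 : lookup w₂ i ≡ 0#
      w₂ⱼ≡1 : lookup w₂ j ≡ 1#

  IsLine⇒Pivots : ∀ {u v} → IsLine (u , v) → Pivots u v
  IsLine⇒Pivots (i , j , i<j , lead-u , lead-v , uⱼ≡0) = record
    { i = i ; j = j ; i≢j = Fin.<⇒≢ i<j
    ; w₁ᵢ≡1 = LeadAt⇒≡1 lead-u ; w₁ⱼ≡0 = uⱼ≡0 ; w₂ᵢ≡0 = LeadAt⇒<≡0 lead-v i<j ; w₂ⱼ≡1 = LeadAt⇒≡1 lead-v }

  PointOnLine-· : ∀ {x ℓ} c → PointOnLine x ℓ → PointOnLine (c · x) ℓ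
  PointOnLine-· {ℓ = w₁ , w₂} c (α , β , refl) = c * α , c * β , ·-comb c α w₁ β w₂

  meet-at : ∀ {w h ℓ} t → lookup w t ≢ 0# → PointOnLine w h → PointOnLine w ℓ → Meet h ℓ
  meet-at {w} t wₜ≢0 w∈h w∈ℓ with normalize-spec w t wₜ≢0
  ... | c , _ , eq , P-point = normalize w , P-point ,
        subst (λ P → PointOnLine P _) (sym eq) (PointOnLine-· c w∈h) ,
        subst (λ P → PointOnLine P _) (sym eq) (PointOnLine-· c w∈ℓ)

  coefficients-≢0 : ∀ {α β w₁ w₂ s} → LeadAt ((α · w₁) ⊕ (β · w₂)) s → α ≢ 0# ⊎ β ≢ 0#
  coefficients-≢0 {α} {β} {w₁} {w₂} {s} lead with α ≟ 0# | β ≟ 0#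
  ... | no α≢0 | _      = inj₁ α≢0
  ... | yes _  | no β≢0 = inj₂ β≢0
  ... | yes α≡0 | yes β≡0 = ⊥-elim (LeadAt⇒≢0 lead (begin
    lookup ((α · w₁) ⊕ (β · w₂)) s          ≡⟨ lookup-comb α w₁ β w₂ s ⟩
    α * lookup w₁ s + β * lookup w₂ s      ≡⟨ cong₂ (λ a b → a * lookup w₁ s + b * lookup w₂ s) α≡0 β≡0 ⟩
    0# * lookup w₁ s + 0# * lookup w₂ s    ≡⟨ solve 2 (λ s t → con (+ 0) :* s :+ con (+ 0) :* t := con (+ 0)) refl _ _ ⟩
    0#                                     ∎))
    where open ≡-Reasoning

  module _ {α₁ β₁ α₂ β₂ : Carrier} (det≡0 : det₂ α₁ β₁ α₂ β₂ ≡ 0#) (w₁ w₂ : V4) (t : Fin 4) where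
    private
      x₁ x₂ : Carrier
      x₁ = lookup ((α₁ · w₁) ⊕ (β₁ · w₂)) t
      x₂ = lookup ((α₂ · w₁) ⊕ (β₂ · w₂)) t
      s = lookup w₁ t
      u = lookup w₂ t

    det₂≡0⇒proportional₁ : α₁ * x₂ ≡ α₂ * x₁
    det₂≡0⇒proportional₁ = begin
      α₁ * x₂                                    ≡⟨ cong (α₁ *_) (lookup-comb α₂ w₁ β₂ w₂ t) ⟩
      α₁ * (α₂ * s + β₂ * u)                     ≡⟨ solve 6 (λ a₁ b₁ a₂ b₂ s u →
            a₁ :* (a₂ :* s :+ b₂ :* u) := a₂ :* (a₁ :* s :+ b₁ :* u) :+ (a₁ :* b₂ :- b₁ :* a₂) :* u) refl α₁ β₁ α₂ β₂ s u ⟩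
      α₂ * (α₁ * s + β₁ * u) + det₂ α₁ β₁ α₂ β₂ * u  ≡⟨ cong (λ d → α₂ * (α₁ * s + β₁ * u) + d * u) det≡0 ⟩
      α₂ * (α₁ * s + β₁ * u) + 0# * u            ≡⟨ solve 2 (λ p u → p :+ con (+ 0) :* u := p) refl _ u ⟩
      α₂ * (α₁ * s + β₁ * u)                     ≡⟨ cong (α₂ *_) (sym (lookup-comb α₁ w₁ β₁ w₂ t)) ⟩
      α₂ * x₁                                    ∎
      where open ≡-Reasoning

    det₂≡0⇒proportional₂ : β₁ * x₂ ≡ β₂ * x₁
    det₂≡0⇒proportional₂ = begin
      β₁ * x₂                                    ≡⟨ cong (β₁ *_) (lookup-comb α₂ w₁ β₂ w₂ t) ⟩
      β₁ * (α₂ * s + β₂ * u)                     ≡⟨ solve 6 (λ a₁ b₁ a₂ b₂ s u →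
            b₁ :* (a₂ :* s :+ b₂ :* u) := b₂ :* (a₁ :* s :+ b₁ :* u) :- (a₁ :* b₂ :- b₁ :* a₂) :* s) refl α₁ β₁ α₂ β₂ s u ⟩
      β₂ * (α₁ * s + β₁ * u) - det₂ α₁ β₁ α₂ β₂ * s  ≡⟨ cong (λ d → β₂ * (α₁ * s + β₁ * u) - d * s) det≡0 ⟩
      β₂ * (α₁ * s + β₁ * u) - 0# * s            ≡⟨ solve 2 (λ p s → p :- con (+ 0) :* s := p) refl _ s ⟩
      β₂ * (α₁ * s + β₁ * u)                     ≡⟨ cong (β₂ *_) (sym (lookup-comb α₁ w₁ β₁ w₂ t)) ⟩
      β₂ * x₁                                    ∎
      where open ≡-Reasoning

  -- Either the coefficient matrix of x₁, x₂ is invertible, or x₁, x₂ are proportional, hence equal.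
  two-points-annihilate-span : ∀ {x₁ x₂ w₁ w₂ z} → Normalized x₁ → Normalized x₂ → x₁ ≢ x₂ →
    PointOnLine x₁ (w₁ , w₂) → PointOnLine x₂ (w₁ , w₂) → dot x₁ z ≡ 0# → dot x₂ z ≡ 0# →
    dot w₁ z ≡ 0# × dot w₂ z ≡ 0#
  two-points-annihilate-span {w₁ = w₁} {w₂} {z} (_ , lead₁) (_ , lead₂) x₁≢x₂
    (α₁ , β₁ , refl) (α₂ , β₂ , refl) x₁z≡0 x₂z≡0 with det₂ α₁ β₁ α₂ β₂ ≟ 0#
  ... | no det≢0 = x*y≡0⇒y≡0 det≢0 (proj₁ annihilated) , x*y≡0⇒y≡0 det≢0 (proj₂ annihilated)
    where
    annihilated = det₂-annihilates (trans (sym (dot-combˡ α₁ w₁ β₁ w₂ z)) x₁z≡0)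
                                   (trans (sym (dot-combˡ α₂ w₁ β₂ w₂ z)) x₂z≡0)
  ... | yes det≡0 with coefficients-≢0 lead₁
  ...   | inj₁ α₁≢0 = ⊥-elim (x₁≢x₂ (LeadAt-proportional⇒≡ lead₁ lead₂ α₁≢0 (det₂≡0⇒proportional₁ det≡0 w₁ w₂)))
  ...   | inj₂ β₁≢0 = ⊥-elim (x₁≢x₂ (LeadAt-proportional⇒≡ lead₁ lead₂ β₁≢0 (det₂≡0⇒proportional₂ det≡0 w₁ w₂)))

  PointOnLine-first : ∀ {w₁ w₂} → PointOnLine w₁ (w₁ , w₂)
  PointOnLine-first {w₁} {w₂} = 1# , 0# , ≗⇒≡ λ t → trans
    (solve 2 (λ s u → s := con (+ 1) :* s :+ con (+ 0) :* u) refl (lookup w₁ t) (lookup w₂ t))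
    (sym (lookup-comb 1# w₁ 0# w₂ t))

  plane-through-two-points-contains-line : ∀ {P₁ P₂ u v τ} → Normalized P₁ → Normalized P₂ → P₁ ≢ P₂ →
    PointOnLine P₁ (u , v) → PointOnLine P₂ (u , v) → PointOnPlane P₁ τ → PointOnPlane P₂ τ → LineInPlane (u , v) τ
  plane-through-two-points-contains-line {P₁} {P₂} {u} {v} {τ} P₁-point P₂-point P₁≢P₂ P₁∈ℓ P₂∈ℓ P₁∈τ P₂∈τ
    with two-points-annihilate-span P₁-point P₂-point P₁≢P₂ P₁∈ℓ P₂∈ℓ
           (trans (dot-comm P₁ τ) P₁∈τ) (trans (dot-comm P₂ τ) P₂∈τ)
  ... | uτ≡0 , vτ≡0 = trans (dot-comm τ u) uτ≡0 , trans (dot-comm τ v) vτ≡0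

  module SpanPoints {w₁ w₂ : V4} (pivots : Pivots w₁ w₂) where
    open Pivots pivots

    lookup-spanᵢ : ∀ α β → lookup ((α · w₁) ⊕ (β · w₂)) i ≡ α
    lookup-spanᵢ α β = begin
      lookup ((α · w₁) ⊕ (β · w₂)) i      ≡⟨ lookup-comb α w₁ β w₂ i ⟩
      α * lookup w₁ i + β * lookup w₂ i  ≡⟨ cong₂ (λ s u → α * s + β * u) w₁ᵢ≡1 w₂ᵢ≡0 ⟩
      α * 1# + β * 0#                    ≡⟨ solve 2 (λ a b → a :* con (+ 1) :+ b :* con (+ 0) := a) refl α β ⟩
      α                                  ∎
      where open ≡-Reasoning

    lookup-spanⱼ : ∀ α β → lookup ((α · w₁) ⊕ (β · w₂)) j ≡ β
    lookup-spanⱼ α β = begin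
      lookup ((α · w₁) ⊕ (β · w₂)) j      ≡⟨ lookup-comb α w₁ β w₂ j ⟩
      α * lookup w₁ j + β * lookup w₂ j  ≡⟨ cong₂ (λ s u → α * s + β * u) w₁ⱼ≡0 w₂ⱼ≡1 ⟩
      α * 0# + β * 1#                    ≡⟨ solve 2 (λ a b → a :* con (+ 0) :+ b :* con (+ 1) := b) refl α β ⟩
      β                                  ∎
      where open ≡-Reasoning

    -- The projective line F ∪ {∞}: `just β` stands for w₁ + β w₂ and `nothing` for w₂.
    coefficients : Maybe Carrier → Carrier × Carrier
    coefficients nothing  = 0# , 1#
    coefficients (just β) = 1# , β

    spanVector : Maybe Carrier → V4
    spanVector m = (proj₁ (coefficients m) · w₁) ⊕ (proj₂ (coefficients m) · w₂)

    spanVector-≢0 : ∀ m → Σ (Fin 4) λ t → lookup (spanVector m) t ≢ 0#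
    spanVector-≢0 nothing  = j , λ eq → 1≢0 (trans (sym (lookup-spanⱼ 0# 1#)) eq)
    spanVector-≢0 (just β) = i , λ eq → 1≢0 (trans (sym (lookup-spanᵢ 1# β)) eq)

    spanPoint : Maybe Carrier → V4
    spanPoint m = normalize (spanVector m)

    spanPoint-spec : ∀ m → Σ Carrier λ c → c ≢ 0# × spanPoint m ≡ c · spanVector m × IsPoint (spanPoint m)
    spanPoint-spec m = normalize-spec (spanVector m) (proj₁ (spanVector-≢0 m)) (proj₂ (spanVector-≢0 m))

    scale : Maybe Carrier → Carrier
    scale m = proj₁ (spanPoint-spec m)

    scale-≢0 : ∀ m → scale m ≢ 0#
    scale-≢0 m = proj₁ (proj₂ (spanPoint-spec m))

    spanPoint-isPoint : ∀ m → IsPoint (spanPoint m)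
    spanPoint-isPoint m = proj₂ (proj₂ (proj₂ (spanPoint-spec m)))

    lookup-spanPoint : ∀ m t → lookup (spanPoint m) t ≡ scale m * lookup (spanVector m) t
    lookup-spanPoint m t = trans (cong (λ x → lookup x t) (proj₁ (proj₂ (proj₂ (spanPoint-spec m)))))
                                 (lookup-· (scale m) (spanVector m) t)

    lookup-spanPointᵢ : ∀ m → lookup (spanPoint m) i ≡ scale m * proj₁ (coefficients m)
    lookup-spanPointᵢ m = trans (lookup-spanPoint m i) (cong (scale m *_) (lookup-spanᵢ _ _))

    lookup-spanPointⱼ : ∀ m → lookup (spanPoint m) j ≡ scale m * proj₂ (coefficients m)
    lookup-spanPointⱼ m = trans (lookup-spanPoint m j) (cong (scale m *_) (lookup-spanⱼ _ _))

    spanPoint-injective : ∀ {m m′} → spanPoint m ≡ spanPoint m′ → m ≡ m′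
    spanPoint-injective {nothing} {nothing} _ = refl
    spanPoint-injective {nothing} {just β′} eq = ⊥-elim (scale-≢0 (just β′) (begin
      scale (just β′)              ≡⟨ sym (*-identityʳ _) ⟩
      scale (just β′) * 1#         ≡⟨ sym (lookup-spanPointᵢ (just β′)) ⟩
      lookup (spanPoint (just β′)) i ≡⟨ cong (λ x → lookup x i) (sym eq) ⟩
      lookup (spanPoint nothing) i ≡⟨ lookup-spanPointᵢ nothing ⟩
      scale nothing * 0#           ≡⟨ zeroʳ _ ⟩
      0#                           ∎))
      where open ≡-Reasoning
    spanPoint-injective {just β} {nothing} eq = sym (spanPoint-injective (sym eq))
    spanPoint-injective {just β} {just β′} eq = cong just (*-cancelˡ (scale-≢0 (just β)) (begin
      c * β                          ≡⟨ sym (lookup-spanPointⱼ (just β)) ⟩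
      lookup (spanPoint (just β)) j  ≡⟨ cong (λ x → lookup x j) eq ⟩
      lookup (spanPoint (just β′)) j ≡⟨ lookup-spanPointⱼ (just β′) ⟩
      c′ * β′                        ≡⟨ cong (_* β′) (sym c≡c′) ⟩
      c * β′                         ∎))
      where
      open ≡-Reasoning
      c = scale (just β)
      c′ = scale (just β′)
      c≡c′ : c ≡ c′
      c≡c′ = begin
        c                              ≡⟨ sym (*-identityʳ c) ⟩
        c * 1#                         ≡⟨ sym (lookup-spanPointᵢ (just β)) ⟩
        lookup (spanPoint (just β)) i  ≡⟨ cong (λ x → lookup x i) eq ⟩
        lookup (spanPoint (just β′)) i ≡⟨ lookup-spanPointᵢ (just β′) ⟩
        c′ * 1#                        ≡⟨ *-identityʳ c′ ⟩
        c′                             ∎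

    projectiveLine : List (Maybe Carrier)
    projectiveLine = nothing ∷ List.map just elements

    spanPoints : List V4
    spanPoints = List.map spanPoint projectiveLine

    projectiveLine-unique : Unique projectiveLine
    projectiveLine-unique = All.map⁺ (All.universal (λ _ ()) elements) ∷ Unique.map⁺ Maybe.just-injective unique

    spanPoints-unique : Unique spanPoints
    spanPoints-unique = Unique.map⁺ spanPoint-injective projectiveLine-unique

    length-spanPoints : List.length spanPoints ≡ suc q
    length-spanPoints = trans (List.length-map spanPoint projectiveLine) (cong ℕ.suc (List.length-map just elements))

    ∈-projectiveLine : ∀ m → m ∈ projectiveLine
    ∈-projectiveLine nothing  = here refl
    ∈-projectiveLine (just β) = there (∈.∈-map⁺ just (complete β))

    spanPoint-∈ : ∀ m → spanPoint m ∈ spanPoints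
    spanPoint-∈ m = ∈.∈-map⁺ spanPoint (∈-projectiveLine m)

    point∈span⇒∈spanPoints : ∀ {x} → IsPoint x → PointOnLine x (w₁ , w₂) → x ∈ spanPoints
    point∈span⇒∈spanPoints (_ , lead) (α , β , refl) with α ≟ 0# | coefficients-≢0 lead
    ... | no α≢0 | _ = subst (_∈ spanPoints) (sym x≡spanPoint) (spanPoint-∈ m)
      where
      α⁻¹ = α ⁻¹⟨ α≢0 ⟩
      m = just (α⁻¹ * β)
      c = scale m
      x≡spanPoint = LeadAt-proportional⇒≡ lead (proj₂ (spanPoint-isPoint m)) α≢0 λ t →
        let s = lookup w₁ t ; u = lookup w₂ t in begin
        α * lookup (spanPoint m) t                 ≡⟨ cong (α *_) (lookup-spanPoint m t) ⟩
        α * (c * lookup (spanVector m) t)          ≡⟨ cong (λ y → α * (c * y)) (lookup-comb 1# w₁ (α⁻¹ * β) w₂ t) ⟩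
        α * (c * (1# * s + (α⁻¹ * β) * u))         ≡⟨ solve 6 (λ a i b c s u → a :* (c :* (con (+ 1) :* s :+ (i :* b) :* u))
                                                          := c :* (a :* s :+ (a :* i) :* b :* u)) refl α α⁻¹ β c s u ⟩
        c * (α * s + (α * α⁻¹) * β * u)            ≡⟨ cong (λ y → c * (α * s + y * β * u)) (*-inverseʳ α α≢0) ⟩
        c * (α * s + 1# * β * u)                   ≡⟨ solve 5 (λ a b c s u → c :* (a :* s :+ con (+ 1) :* b :* u)
                                                          := c :* (a :* s :+ b :* u)) refl α β c s u ⟩
        c * (α * s + β * u)                        ≡⟨ cong (c *_) (sym (lookup-comb α w₁ β w₂ t)) ⟩
        c * lookup ((α · w₁) ⊕ (β · w₂)) t         ∎
        where open ≡-Reasoning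
    ... | yes α≡0 | inj₁ α≢0 = ⊥-elim (α≢0 α≡0)
    ... | yes α≡0 | inj₂ β≢0 = subst (_∈ spanPoints) (sym x≡spanPoint) (spanPoint-∈ nothing)
      where
      c = scale nothing
      x≡spanPoint = LeadAt-proportional⇒≡ lead (proj₂ (spanPoint-isPoint nothing)) β≢0 λ t →
        let s = lookup w₁ t ; u = lookup w₂ t in begin
        β * lookup (spanPoint nothing) t           ≡⟨ cong (β *_) (lookup-spanPoint nothing t) ⟩
        β * (c * lookup (spanVector nothing) t)    ≡⟨ cong (λ y → β * (c * y)) (lookup-comb 0# w₁ 1# w₂ t) ⟩
        β * (c * (0# * s + 1# * u))                ≡⟨ solve 4 (λ b c s u → b :* (c :* (con (+ 0) :* s :+ con (+ 1) :* u))
                                                          := c :* (con (+ 0) :* s :+ b :* u)) refl β c s u ⟩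
        c * (0# * s + β * u)                       ≡⟨ cong (λ a → c * (a * s + β * u)) (sym α≡0) ⟩
        c * (α * s + β * u)                        ≡⟨ cong (c *_) (sym (lookup-comb α w₁ β w₂ t)) ⟩
        c * lookup ((α · w₁) ⊕ (β · w₂)) t         ∎
        where open ≡-Reasoning

    ∈spanPoints⇒point∈span : ∀ {x} → x ∈ spanPoints → IsPoint x × PointOnLine x (w₁ , w₂)
    ∈spanPoints⇒point∈span x∈ with ∈.∈-map⁻ spanPoint {xs = projectiveLine} x∈
    ... | m , _ , refl with spanPoint-spec m
    ...   | c , _ , eq , point = point ,
      subst (λ P → PointOnLine P (w₁ , w₂)) (sym eq) (PointOnLine-· c (proj₁ (coefficients m) , proj₂ (coefficients m) , refl))

module LineGeometry (F : FiniteField) {u v : PG3.V4 F} (pivots : Spans.Pivots F u v) where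
  open FieldArithmetic F
  open Coordinates F
  open PG3 F
  open Spans F
  open Pivots pivots renaming (w₁ᵢ≡1 to uᵢ≡1; w₁ⱼ≡0 to uⱼ≡0; w₂ᵢ≡0 to vᵢ≡0; w₂ⱼ≡1 to vⱼ≡1)

  open Complement (complement i j i≢j)

  -- The forms σ k, σ m are coordinates on F⁴/ℓ, and they span the pencil of planes through ℓ.
  σ : Fin 4 → V4
  σ c = unit c ⊕ (((- lookup u c) · unit i) ⊕ ((- lookup v c) · unit j))

  dot-σ : ∀ c x → dot (σ c) x ≡ lookup x c - (lookup u c * lookup x i + lookup v c * lookup x j)
  dot-σ c x = begin
    dot (σ c) x
      ≡⟨ dot-⊕ˡ (unit c) _ x ⟩
    dot (unit c) x + dot (((- lookup u c) · unit i) ⊕ ((- lookup v c) · unit j)) x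
      ≡⟨ cong₂ _+_ (dot-unitˡ c x) (dot-combˡ (- lookup u c) (unit i) (- lookup v c) (unit j) x) ⟩
    lookup x c + ((- lookup u c) * dot (unit i) x + (- lookup v c) * dot (unit j) x)
      ≡⟨ cong₂ (λ s t → lookup x c + ((- lookup u c) * s + (- lookup v c) * t)) (dot-unitˡ i x) (dot-unitˡ j x) ⟩
    lookup x c + ((- lookup u c) * lookup x i + (- lookup v c) * lookup x j)
      ≡⟨ solve 5 (λ xc uc xi vc xj → xc :+ ((:- uc) :* xi :+ (:- vc) :* xj) := xc :- (uc :* xi :+ vc :* xj))
               refl (lookup x c) (lookup u c) (lookup x i) (lookup v c) (lookup x j) ⟩
    lookup x c - (lookup u c * lookup x i + lookup v c * lookup x j)
      ∎
    where open ≡-Reasoning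

  σ-annihilates-u : ∀ c → dot (σ c) u ≡ 0#
  σ-annihilates-u c = begin
    dot (σ c) u
      ≡⟨ dot-σ c u ⟩
    lookup u c - (lookup u c * lookup u i + lookup v c * lookup u j)
      ≡⟨ cong₂ (λ s t → lookup u c - (lookup u c * s + lookup v c * t)) uᵢ≡1 uⱼ≡0 ⟩
    lookup u c - (lookup u c * 1# + lookup v c * 0#)
      ≡⟨ solve 2 (λ a b → a :- (a :* con (+ 1) :+ b :* con (+ 0)) := con (+ 0)) refl _ _ ⟩
    0#
      ∎
    where open ≡-Reasoning

  σ-annihilates-v : ∀ c → dot (σ c) v ≡ 0#
  σ-annihilates-v c = begin
    dot (σ c) v
      ≡⟨ dot-σ c v ⟩
    lookup v c - (lookup u c * lookup v i + lookup v c * lookup v j)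
      ≡⟨ cong₂ (λ s t → lookup v c - (lookup u c * s + lookup v c * t)) vᵢ≡0 vⱼ≡1 ⟩
    lookup v c - (lookup u c * 0# + lookup v c * 1#)
      ≡⟨ solve 2 (λ a b → b :- (a :* con (+ 0) :+ b :* con (+ 1)) := con (+ 0)) refl _ _ ⟩
    0#
      ∎
    where open ≡-Reasoning

  lookup-σ : ∀ c t → lookup (σ c) t ≡ lookup (unit t) c - (lookup u c * lookup (unit t) i + lookup v c * lookup (unit t) j)
  lookup-σ c t = trans (sym (dot-unitˡ t (σ c))) (trans (dot-comm (unit t) (σ c)) (dot-σ c (unit t)))

  lookup-σ-≡ : ∀ {c} → c ≢ i → c ≢ j → lookup (σ c) c ≡ 1#
  lookup-σ-≡ {c} c≢i c≢j = begin
    lookup (σ c) c                                                              ≡⟨ lookup-σ c c ⟩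
    lookup (unit c) c - (lookup u c * lookup (unit c) i + lookup v c * lookup (unit c) j)
      ≡⟨ cong₂ (λ s t → s - (lookup u c * t + lookup v c * lookup (unit c) j)) (lookup-unit-≡ c) (lookup-unit-≢ (≢-sym c≢i)) ⟩
    1# - (lookup u c * 0# + lookup v c * lookup (unit c) j)
      ≡⟨ cong (λ t → 1# - (lookup u c * 0# + lookup v c * t)) (lookup-unit-≢ (≢-sym c≢j)) ⟩
    1# - (lookup u c * 0# + lookup v c * 0#)
      ≡⟨ solve 2 (λ a b → con (+ 1) :- (a :* con (+ 0) :+ b :* con (+ 0)) := con (+ 1)) refl _ _ ⟩
    1#                                                                          ∎
    where open ≡-Reasoning

  lookup-σ-≢ : ∀ {c t} → c ≢ t → t ≢ i → t ≢ j → lookup (σ c) t ≡ 0#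
  lookup-σ-≢ {c} {t} c≢t t≢i t≢j = begin
    lookup (σ c) t                                                              ≡⟨ lookup-σ c t ⟩
    lookup (unit t) c - (lookup u c * lookup (unit t) i + lookup v c * lookup (unit t) j)
      ≡⟨ cong₂ (λ s r → s - (lookup u c * r + lookup v c * lookup (unit t) j)) (lookup-unit-≢ c≢t) (lookup-unit-≢ (≢-sym t≢i)) ⟩
    0# - (lookup u c * 0# + lookup v c * lookup (unit t) j)
      ≡⟨ cong (λ r → 0# - (lookup u c * 0# + lookup v c * r)) (lookup-unit-≢ (≢-sym t≢j)) ⟩
    0# - (lookup u c * 0# + lookup v c * 0#)
      ≡⟨ solve 2 (λ a b → con (+ 0) :- (a :* con (+ 0) :+ b :* con (+ 0)) := con (+ 0)) refl _ _ ⟩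
    0#                                                                          ∎
    where open ≡-Reasoning

  σ-pivots : Pivots (σ k) (σ m)
  σ-pivots = record
    { i = k ; j = m ; i≢j = k≢m
    ; w₁ᵢ≡1 = lookup-σ-≡ k≢i k≢j ; w₁ⱼ≡0 = lookup-σ-≢ k≢m m≢i m≢j
    ; w₂ᵢ≡0 = lookup-σ-≢ (≢-sym k≢m) k≢i k≢j ; w₂ⱼ≡1 = lookup-σ-≡ m≢i m≢j }

  σ-annihilates⇒coordinate : ∀ {c x} → dot (σ c) x ≡ 0# → lookup x c ≡ lookup x i * lookup u c + lookup x j * lookup v c
  σ-annihilates⇒coordinate {c} {x} σx≡0 = trans (x-y≡0⇒x≡y (trans (sym (dot-σ c x)) σx≡0))
    (solve 4 (λ uc xi vc xj → uc :* xi :+ vc :* xj := xi :* uc :+ xj :* vc) refl _ _ _ _)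

  σᵢ-annihilates : ∀ x → dot (σ i) x ≡ 0#
  σᵢ-annihilates x = begin
    dot (σ i) x
      ≡⟨ dot-σ i x ⟩
    lookup x i - (lookup u i * lookup x i + lookup v i * lookup x j)
      ≡⟨ cong₂ (λ s t → lookup x i - (s * lookup x i + t * lookup x j)) uᵢ≡1 vᵢ≡0 ⟩
    lookup x i - (1# * lookup x i + 0# * lookup x j)
      ≡⟨ solve 2 (λ a b → a :- (con (+ 1) :* a :+ con (+ 0) :* b) := con (+ 0)) refl _ _ ⟩
    0#
      ∎
    where open ≡-Reasoning

  σⱼ-annihilates : ∀ x → dot (σ j) x ≡ 0#
  σⱼ-annihilates x = begin
    dot (σ j) x
      ≡⟨ dot-σ j x ⟩
    lookup x j - (lookup u j * lookup x i + lookup v j * lookup x j)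
      ≡⟨ cong₂ (λ s t → lookup x j - (s * lookup x i + t * lookup x j)) uⱼ≡0 vⱼ≡1 ⟩
    lookup x j - (0# * lookup x i + 1# * lookup x j)
      ≡⟨ solve 2 (λ a b → b :- (con (+ 0) :* a :+ con (+ 1) :* b) := con (+ 0)) refl _ _ ⟩
    0#
      ∎
    where open ≡-Reasoning

  σ-annihilates⇒onLine : ∀ {x} → dot (σ k) x ≡ 0# → dot (σ m) x ≡ 0# → PointOnLine x (u , v)
  σ-annihilates⇒onLine {x} σₖx≡0 σₘx≡0 = lookup x i , lookup x j , ≗⇒≡ λ t →
    trans (σ-annihilates⇒coordinate (σ-annihilates t)) (sym (lookup-comb (lookup x i) u (lookup x j) v t))
    where
    σ-annihilates : ∀ t → dot (σ t) x ≡ 0#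
    σ-annihilates t with cover t
    ... | inj₁ refl               = σᵢ-annihilates x
    ... | inj₂ (inj₁ refl)        = σⱼ-annihilates x
    ... | inj₂ (inj₂ (inj₁ refl)) = σₖx≡0
    ... | inj₂ (inj₂ (inj₂ refl)) = σₘx≡0

  annihilator-vanishes : ∀ {z} → lookup z k ≡ 0# → lookup z m ≡ 0# → dot z u ≡ 0# → dot z v ≡ 0# → ∀ t → lookup z t ≡ 0#
  annihilator-vanishes {z} zₖ≡0 zₘ≡0 zu≡0 zv≡0 t with cover t
  ... | inj₁ refl               = zᵢ≡0
    where
    zᵢ≡0 : lookup z i ≡ 0#
    zᵢ≡0 = dot-single≡0 {z} {u} uᵢ≡1 others zu≡0
      where
      others : ∀ t → t ≢ i → lookup z t * lookup u t ≡ 0#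
      others t t≢i with cover t
      ... | inj₁ t≡i                = ⊥-elim (t≢i t≡i)
      ... | inj₂ (inj₁ refl)        = trans (cong (lookup z t *_) uⱼ≡0) (zeroʳ _)
      ... | inj₂ (inj₂ (inj₁ refl)) = trans (cong (_* lookup u t) zₖ≡0) (zeroˡ _)
      ... | inj₂ (inj₂ (inj₂ refl)) = trans (cong (_* lookup u t) zₘ≡0) (zeroˡ _)
  ... | inj₂ (inj₁ refl)        = dot-single≡0 {z} {v} vⱼ≡1 others zv≡0
    where
    others : ∀ s → s ≢ j → lookup z s * lookup v s ≡ 0#
    others s s≢j with cover s
    ... | inj₁ refl               = trans (cong (lookup z s *_) vᵢ≡0) (zeroʳ _)
    ... | inj₂ (inj₁ s≡j)         = ⊥-elim (s≢j s≡j)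
    ... | inj₂ (inj₂ (inj₁ refl)) = trans (cong (_* lookup v s) zₖ≡0) (zeroˡ _)
    ... | inj₂ (inj₂ (inj₂ refl)) = trans (cong (_* lookup v s) zₘ≡0) (zeroˡ _)
  ... | inj₂ (inj₂ (inj₁ refl)) = zₖ≡0
  ... | inj₂ (inj₂ (inj₂ refl)) = zₘ≡0

  onPencil⇒inPlane : ∀ {π} → PointOnLine π (σ k , σ m) → LineInPlane (u , v) π
  onPencil⇒inPlane (α , β , refl) = annihilates u σ-annihilates-u , annihilates v σ-annihilates-v
    where
    annihilates : ∀ x → (∀ c → dot (σ c) x ≡ 0#) → dot ((α · σ k) ⊕ (β · σ m)) x ≡ 0#
    annihilates x σx≡0 = begin
      dot ((α · σ k) ⊕ (β · σ m)) x          ≡⟨ dot-combˡ α (σ k) β (σ m) x ⟩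
      α * dot (σ k) x + β * dot (σ m) x      ≡⟨ cong₂ (λ s t → α * s + β * t) (σx≡0 k) (σx≡0 m) ⟩
      α * 0# + β * 0#                        ≡⟨ solve 2 (λ a b → a :* con (+ 0) :+ b :* con (+ 0) := con (+ 0)) refl α β ⟩
      0#                                     ∎
      where open ≡-Reasoning

  inPlane⇒onPencil : ∀ {π} → LineInPlane (u , v) π → PointOnLine π (σ k , σ m)
  inPlane⇒onPencil {π} (πu≡0 , πv≡0) = πₖ , πₘ , ≗⇒≡ λ t →
    x-y≡0⇒x≡y (trans (sym (lookup-⊖ π π′ t)) (annihilator-vanishes {π ⊖ π′} (agree k (lookup-spanᵢ πₖ πₘ))
      (agree m (lookup-spanⱼ πₖ πₘ)) (both-annihilate u πu≡0 (proj₁ π′⊆π)) (both-annihilate v πv≡0 (proj₂ π′⊆π)) t))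
    where
    open SpanPoints σ-pivots using (lookup-spanᵢ; lookup-spanⱼ)
    πₖ = lookup π k
    πₘ = lookup π m
    π′ = (πₖ · σ k) ⊕ (πₘ · σ m)
    π′⊆π = onPencil⇒inPlane {π′} (πₖ , πₘ , refl)
    agree : ∀ c → lookup π′ c ≡ lookup π c → lookup (π ⊖ π′) c ≡ 0#
    agree c π′꜀≡π꜀ = trans (lookup-⊖ π π′ c) (trans (cong (λ y → lookup π c - y) π′꜀≡π꜀) (x-x≡0 _))
    both-annihilate : ∀ x → dot π x ≡ 0# → dot π′ x ≡ 0# → dot (π ⊖ π′) x ≡ 0#
    both-annihilate x πx≡0 π′x≡0 = trans (dot-⊖ˡ π π′ x) (trans (cong₂ _-_ πx≡0 π′x≡0) (x-x≡0 0#))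

  point-on-two-planes-lies-on-line : ∀ {π₁ π₂ Q} → IsPlane π₁ → IsPlane π₂ → π₁ ≢ π₂ →
    LineInPlane (u , v) π₁ → LineInPlane (u , v) π₂ → PointOnPlane Q π₁ → PointOnPlane Q π₂ → PointOnLine Q (u , v)
  point-on-two-planes-lies-on-line π₁-plane π₂-plane π₁≢π₂ ℓ⊆π₁ ℓ⊆π₂ Q∈π₁ Q∈π₂ =
    uncurry σ-annihilates⇒onLine
      (two-points-annihilate-span π₁-plane π₂-plane π₁≢π₂
        (inPlane⇒onPencil ℓ⊆π₁) (inPlane⇒onPencil ℓ⊆π₂) Q∈π₁ Q∈π₂)

  module _ {u′ v′ : V4} (h-pivots : Pivots u′ v′) where
    private
      open Pivots h-pivots using () renaming (i to i′; j to j′; w₁ᵢ≡1 to u′ᵢ′≡1; w₁ⱼ≡0 to u′ⱼ′≡0; w₂ⱼ≡1 to v′ⱼ′≡1)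
      a b c d : Carrier
      a = dot (σ k) u′
      b = dot (σ m) u′
      c = dot (σ k) v′
      d = dot (σ m) v′

    meet-through-combination : ∀ γ δ → δ ≢ 0# → γ * a + δ * c ≡ 0# → γ * b + δ * d ≡ 0# → Meet (u′ , v′) (u , v)
    meet-through-combination γ δ δ≢0 σₖw≡0 σₘw≡0 = meet-at j′ wⱼ′≢0 (γ , δ , refl)
      (σ-annihilates⇒onLine (trans (dot-combʳ (σ k) γ u′ δ v′) σₖw≡0) (trans (dot-combʳ (σ m) γ u′ δ v′) σₘw≡0))
      where
      wⱼ′≢0 : lookup ((γ · u′) ⊕ (δ · v′)) j′ ≢ 0#
      wⱼ′≢0 wⱼ′≡0 = δ≢0 (begin
        δ                                        ≡⟨ solve 2 (λ g d → d := g :* con (+ 0) :+ d :* con (+ 1)) refl γ δ ⟩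
        γ * 0# + δ * 1#                          ≡⟨ sym (cong₂ (λ s t → γ * s + δ * t) u′ⱼ′≡0 v′ⱼ′≡1) ⟩
        γ * lookup u′ j′ + δ * lookup v′ j′      ≡⟨ sym (lookup-comb γ u′ δ v′ j′) ⟩
        lookup ((γ · u′) ⊕ (δ · v′)) j′          ≡⟨ wⱼ′≡0 ⟩
        0#                                       ∎)
        where open ≡-Reasoning

    pencil-det≡0 : ∀ {τ s} → PointOnLine τ (σ k , σ m) → LeadAt τ s → dot τ u′ ≡ 0# → dot τ v′ ≡ 0# → det₂ a b c d ≡ 0#
    pencil-det≡0 (α , β , refl) τ-lead τu′≡0 τv′≡0 =
      [ (λ α≢0 → x*y≡0⇒x≡0 α≢0 (proj₁ annihilated)) , (λ β≢0 → x*y≡0⇒x≡0 β≢0 (proj₂ annihilated)) ]′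
        (coefficients-≢0 τ-lead)
      where
      on-τ : ∀ x → dot ((α · σ k) ⊕ (β · σ m)) x ≡ 0# → dot (σ k) x * α + dot (σ m) x * β ≡ 0#
      on-τ x τx≡0 = trans (solve 4 (λ a b s t → s :* a :+ t :* b := a :* s :+ b :* t) refl α β (dot (σ k) x) (dot (σ m) x))
                          (trans (sym (dot-combˡ α (σ k) β (σ m) x)) τx≡0)
      annihilated = det₂-annihilates (on-τ u′ τu′≡0) (on-τ v′ τv′≡0)

    coplanar⇒det≡0 : ∀ {τ} → IsPlane τ → LineInPlane (u , v) τ → LineInPlane (u′ , v′) τ → det₂ a b c d ≡ 0#
    coplanar⇒det≡0 (_ , τ-lead) ℓ⊆τ (u′∈τ , v′∈τ) = pencil-det≡0 (inPlane⇒onPencil ℓ⊆τ) τ-lead u′∈τ v′∈τ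

    coplanar-lines-meet : ∀ {τ} → IsPlane τ → LineInPlane (u , v) τ → LineInPlane (u′ , v′) τ → Meet (u′ , v′) (u , v)
    coplanar-lines-meet τ-plane ℓ⊆τ h⊆τ with a ≟ 0# | b ≟ 0#
    ... | no a≢0 | _ = meet-through-combination (- c) a a≢0
      (solve 2 (λ a c → (:- c) :* a :+ a :* c := con (+ 0)) refl a c)
      (trans (solve 4 (λ a b c d → (:- c) :* b :+ a :* d := a :* d :- b :* c) refl a b c d) det≡0)
      where det≡0 = coplanar⇒det≡0 τ-plane ℓ⊆τ h⊆τ
    ... | yes _ | no b≢0 = meet-through-combination (- d) b b≢0
      (trans (solve 4 (λ a b c d → (:- d) :* a :+ b :* c := (:- con (+ 1)) :* (a :* d :- b :* c)) refl a b c d)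
             (trans (cong (- 1# *_) det≡0) (zeroʳ _)))
      (solve 2 (λ b d → (:- d) :* b :+ b :* d := con (+ 0)) refl b d)
      where det≡0 = coplanar⇒det≡0 τ-plane ℓ⊆τ h⊆τ
    ... | yes a≡0 | yes b≡0 = meet-at i′ (λ u′ᵢ′≡0 → 1≢0 (trans (sym u′ᵢ′≡1) u′ᵢ′≡0)) PointOnLine-first
      (σ-annihilates⇒onLine a≡0 b≡0)

module Enumeration (F : FiniteField) where
  open FieldArithmetic F
  open PG3 F

  allVecs≡cartesianProduct : ∀ n → allVecs (suc n) ≡ List.cartesianProductWith _∷_ elements (allVecs n)
  allVecs≡cartesianProduct n = go elements
    where
    go : ∀ xs → List.concatMap (λ x → List.map (x ∷_) (allVecs n)) xs ≡ List.cartesianProductWith _∷_ xs (allVecs n)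
    go []       = refl
    go (x ∷ xs) = cong (List.map (x ∷_) (allVecs n) List.++_) (go xs)

  ∈-allVecs : ∀ {n} (x : Vec Carrier n) → x ∈ allVecs n
  ∈-allVecs []      = here refl
  ∈-allVecs {suc n} (a ∷ x) = subst ((a ∷ x) ∈_) (sym (allVecs≡cartesianProduct n))
    (∈.∈-cartesianProductWith⁺ _∷_ (complete a) (∈-allVecs x))

  allVecs-unique : ∀ n → Unique (allVecs n)
  allVecs-unique zero    = [] ∷ []
  allVecs-unique (suc n) = subst Unique (sym (allVecs≡cartesianProduct n))
    (Unique.cartesianProductWith⁺ _∷_ V.∷-injective unique (allVecs-unique n))

  search : ∀ {A : Set} {P : A → Set} (xs : List A) → (∀ x → x ∈ xs) → (∀ x → Dec (P x)) → Dec (Σ A P)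
  search xs ∈xs P? with Any.any? P? xs
  ... | yes some = yes (satisfied some)
  ... | no none  = no λ (x , px) → none (lose (∈xs x) px)

  LeadAt? : ∀ {n} (x : Vec Carrier n) i → Dec (LeadAt x i)
  LeadAt? (a ∷ x) Fin.zero    = a ≟ 1#
  LeadAt? (a ∷ x) (Fin.suc i) = (a ≟ 0#) ×-dec LeadAt? x i

  IsPoint? : ∀ x → Dec (IsPoint x)
  IsPoint? x = Fin.any? (LeadAt? x)

  PointOnLine? : ∀ P ℓ → Dec (PointOnLine P ℓ)
  PointOnLine? P (u , v) = search elements complete λ α → search elements complete λ β →
    V.≡-dec _≟_ P ((α · u) ⊕ (β · v))

  PointOnPlane? : ∀ P π → Dec (PointOnPlane P π)
  PointOnPlane? P π = dot π P ≟ 0#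

  Meet? : ∀ h ℓ → Dec (Meet h ℓ)
  Meet? h ℓ = search (allVecs 4) ∈-allVecs λ P → IsPoint? P ×-dec PointOnLine? P h ×-dec PointOnLine? P ℓ

  _≟ᵀ_ : (c d : Triple) → Dec (c ≡ d)
  _≟ᵀ_ = Product.≡-dec _≟ⱽ_ (Product.≡-dec (Product.≡-dec _≟ⱽ_ _≟ⱽ_) _≟ⱽ_)
    where
    _≟ⱽ_ : (x y : V4) → Dec (x ≡ y)
    _≟ⱽ_ = V.≡-dec _≟_

  length-trichotomy : ∀ {A : Set} {xs : List A} → Unique xs →
    List.length xs ≡ 0 ⊎ List.length xs ≡ 1 ⊎ ∃₂ λ x y → x ≢ y × x ∈ xs × y ∈ xs
  length-trichotomy {xs = []}        _               = inj₁ refl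
  length-trichotomy {xs = x ∷ []}    _               = inj₂ (inj₁ refl)
  length-trichotomy {xs = x ∷ y ∷ _} ((x≢y ∷ _) ∷ _) = inj₂ (inj₂ (x , y , x≢y , here refl , there (here refl)))

  q≢0 : q ≢ 0
  q≢0 = nonempty (complete 0#)
    where
    nonempty : ∀ {x : Carrier} {xs} → x ∈ xs → List.length xs ≢ 0
    nonempty (here _)  ()
    nonempty (there _) ()

  module _ (p : V4 → Bool) where
    private
      p? : ∀ x → Dec (T (p x))
      p? x = T? (p x)

    filtered : List V4
    filtered = List.filterᵇ p (allVecs 4)

    filtered-unique : Unique filtered
    filtered-unique = Unique.filter⁺ p? (allVecs-unique 4)

    ∈-filtered⇔ : ∀ {x} → x ∈ filtered ⇔ p x ≡ true
    ∈-filtered⇔ {x} = mk⇔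
      (λ x∈ → Equivalence.to Bool.T-≡ (proj₂ (∈.∈-filter⁻ p? {xs = allVecs 4} x∈)))
      (λ px → ∈.∈-filter⁺ p? (∈-allVecs x) (Equivalence.from Bool.T-≡ px))

    length-filtered : ∀ {K} → Unique K → (∀ {x} → x ∈ K ⇔ p x ≡ true) → List.length filtered ≡ List.length K
    length-filtered K-unique ∈K⇔ = ↭-length (∼bag⇒↭ (unique∧set⇒bag filtered-unique K-unique
      (mk⇔ (λ x∈ → Equivalence.from ∈K⇔ (Equivalence.to ∈-filtered⇔ x∈))
           (λ x∈ → Equivalence.from ∈-filtered⇔ (Equivalence.to ∈K⇔ x∈)))))

    TwoMembers : Set
    TwoMembers = ∃₂ λ x y → x ≢ y × p x ≡ true × p y ≡ true

    weight-trichotomy : (TwoMembers → List.length filtered ≡ suc q) →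
      List.length filtered ≡ 0 ⊎ List.length filtered ≡ 1 ⊎ List.length filtered ≡ suc q
    weight-trichotomy full with length-trichotomy filtered-unique
    ... | inj₁ empty = inj₁ empty
    ... | inj₂ (inj₁ single) = inj₂ (inj₁ single)
    ... | inj₂ (inj₂ (x , y , x≢y , x∈ , y∈)) =
      inj₂ (inj₂ (full (x , y , x≢y , Equivalence.to ∈-filtered⇔ x∈ , Equivalence.to ∈-filtered⇔ y∈)))

    weight≡1+q⇒TwoMembers : List.length filtered ≡ suc q → TwoMembers
    weight≡1+q⇒TwoMembers w≡1+q with length-trichotomy filtered-unique
    ... | inj₁ empty = ⊥-elim (ℕ.0≢1+n (trans (sym empty) w≡1+q))
    ... | inj₂ (inj₁ single) = ⊥-elim (q≢0 (ℕ.suc-injective (trans (sym w≡1+q) single)))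
    ... | inj₂ (inj₂ (x , y , x≢y , x∈ , y∈)) = x , y , x≢y , Equivalence.to ∈-filtered⇔ x∈ , Equivalence.to ∈-filtered⇔ y∈

module Chambers (F : FiniteField) where
  open FieldArithmetic F
  open PG3 F
  open Enumeration F

  Meet-sym : ∀ {ℓ h} → Meet ℓ h → Meet h ℓ
  Meet-sym (P , P-point , P∈ℓ , P∈h) = P , P-point , P∈h , P∈ℓ

  Opposite-sym : ∀ c d → Opposite c d → Opposite d c
  Opposite-sym _ _ (P₁∉π₂ , P₂∉π₁ , skew) = P₂∉π₁ , P₁∉π₂ , λ meet → skew (Meet-sym meet)

  Meet⇒¬Opposite : ∀ {P₁ ℓ₁ π₁ P₂ ℓ₂ π₂} → Meet ℓ₂ ℓ₁ → ¬ Opposite (P₁ , ℓ₁ , π₁) (P₂ , ℓ₂ , π₂)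
  Meet⇒¬Opposite meet (_ , _ , skew) = skew (Meet-sym meet)

  chamber-¬self-opposite : ∀ {c} → IsChamber c → ¬ Opposite c c
  chamber-¬self-opposite {P , ℓ , π} (P-point , _ , _ , P∈ℓ , _) = Meet⇒¬Opposite {P} {ℓ} {π} {P} {ℓ} {π} (P , P-point , P∈ℓ , P∈ℓ)

  ∨-≡true : ∀ a b → a ∨ b ≡ true → a ≡ true ⊎ b ≡ true
  ∨-≡true true  _ _    = inj₁ refl
  ∨-≡true false _ b≡true = inj₂ b≡true

  module _ {M : Triple → Bool} (maximal : MaximalIndependent M) where
    private
      chambers    = proj₁ (proj₁ maximal)
      independent = proj₂ (proj₁ maximal)

    maximal-absorbs : ∀ {c} → IsChamber c → (∀ d → M d ≡ true → ¬ Opposite c d) → M c ≡ true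
    maximal-absorbs {c} c-chamber c-compatible =
      proj₂ maximal N (N-chambers , N-independent) (λ d d∈M → cong (_∨ does (d ≟ᵀ c)) d∈M) c c∈N
      where
      N : Triple → Bool
      N d = M d ∨ does (d ≟ᵀ c)

      c∈N : N c ≡ true
      c∈N with c ≟ᵀ c
      ... | yes _   = Bool.∨-zeroʳ (M c)
      ... | no c≢c = ⊥-elim (c≢c refl)

      ∈N : ∀ d → N d ≡ true → M d ≡ true ⊎ d ≡ c
      ∈N d d∈N with d ≟ᵀ c | ∨-≡true (M d) _ d∈N
      ... | _       | inj₁ d∈M = inj₁ d∈M
      ... | yes d≡c | inj₂ _   = inj₂ d≡c

      N-chambers : SetOfChambers N
      N-chambers d d∈N with ∈N d d∈N
      ... | inj₁ d∈M  = chambers d d∈M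
      ... | inj₂ refl = c-chamber

      N-independent : ∀ d e → N d ≡ true → N e ≡ true → ¬ Opposite d e
      N-independent d e d∈N e∈N with ∈N d d∈N | ∈N e e∈N
      ... | inj₁ d∈M  | inj₁ e∈M  = independent d e d∈M e∈M
      ... | inj₁ d∈M  | inj₂ refl = λ opp → c-compatible d d∈M (Opposite-sym d c opp)
      ... | inj₂ refl | inj₁ e∈M  = c-compatible e e∈M
      ... | inj₂ refl | inj₂ refl = chamber-¬self-opposite c-chamber

    non-opposite⇒on-plane : ∀ {P₁ ℓ₁ π₁ P₂ ℓ₂ π₂} → M (P₁ , ℓ₁ , π₁) ≡ true → M (P₂ , ℓ₂ , π₂) ≡ true →
      ¬ PointOnPlane P₂ π₁ → Skew ℓ₁ ℓ₂ → PointOnPlane P₁ π₂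
    non-opposite⇒on-plane {P₁} {π₂ = π₂} c∈M d∈M P₂∉π₁ skew with PointOnPlane? P₁ π₂
    ... | yes P₁∈π₂ = P₁∈π₂
    ... | no P₁∉π₂  = ⊥-elim (independent _ _ c∈M d∈M (P₁∉π₂ , P₂∉π₁ , skew))

module Dominance (F : FiniteField) {M : PG3.Triple F → Bool} (maximal : PG3.MaximalIndependent F M) where
  open FieldArithmetic F
  open PG3 F
  open Spans F
  open Enumeration F
  open Chambers F

  private
    chambers = proj₁ (proj₁ maximal)

  two-points⇒dominant : ∀ {P₁ P₂ u v π} → P₁ ≢ P₂ → M (P₁ , (u , v) , π) ≡ true → M (P₂ , (u , v) , π) ≡ true →
    ∀ Q h τ → M (Q , h , τ) ≡ true → Meet h (u , v) ⊎ PointOnPlane Q π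
  two-points⇒dominant {P₁} {P₂} {u} {v} {π} P₁≢P₂ c₁∈M c₂∈M Q (u′ , v′) τ d∈M
    with PointOnPlane? Q π | Meet? (u′ , v′) (u , v) | chambers _ c₁∈M | chambers _ c₂∈M | chambers _ d∈M
  ... | yes Q∈π | _        | _ | _ | _ = inj₂ Q∈π
  ... | no _    | yes meet | _ | _ | _ = inj₁ meet
  ... | no Q∉π  | no h∦ℓ   | P₁-point , ℓ-line , _ , P₁∈ℓ , _ | P₂-point , _ , _ , P₂∈ℓ , _ | _ , h-line , τ-plane , _ , h⊆τ =
    inj₁ (LineGeometry.coplanar-lines-meet F (IsLine⇒Pivots ℓ-line) (IsLine⇒Pivots h-line) τ-plane ℓ⊆τ h⊆τ)
    where
    skew : Skew (u , v) (u′ , v′)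
    skew meet = h∦ℓ (Meet-sym meet)
    P₁∈τ : PointOnPlane P₁ τ
    P₁∈τ = non-opposite⇒on-plane maximal c₁∈M d∈M Q∉π skew
    P₂∈τ : PointOnPlane P₂ τ
    P₂∈τ = non-opposite⇒on-plane maximal c₂∈M d∈M Q∉π skew
    ℓ⊆τ : LineInPlane (u , v) τ
    ℓ⊆τ = plane-through-two-points-contains-line {τ = τ} P₁-point P₂-point P₁≢P₂ P₁∈ℓ P₂∈ℓ P₁∈τ P₂∈τ

  two-planes⇒dominant : ∀ {P u v π₁ π₂} → π₁ ≢ π₂ → M (P , (u , v) , π₁) ≡ true → M (P , (u , v) , π₂) ≡ true →
    ∀ Q h τ → M (Q , h , τ) ≡ true → Meet h (u , v) ⊎ PointOnPlane P τ
  two-planes⇒dominant {P} {u} {v} {π₁} {π₂} π₁≢π₂ c₁∈M c₂∈M Q h τ d∈M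
    with PointOnPlane? P τ | Meet? h (u , v) | chambers _ c₁∈M | chambers _ c₂∈M | chambers _ d∈M
  ... | yes P∈τ | _        | _ | _ | _ = inj₂ P∈τ
  ... | no _    | yes meet | _ | _ | _ = inj₁ meet
  ... | no P∉τ  | no h∦ℓ   | _ , ℓ-line , π₁-plane , _ , ℓ⊆π₁ | _ , _ , π₂-plane , _ , ℓ⊆π₂ | Q-point , _ , _ , Q∈h , _ =
    inj₁ (Q , Q-point , Q∈h ,
      LineGeometry.point-on-two-planes-lies-on-line F (IsLine⇒Pivots ℓ-line)
        π₁-plane π₂-plane π₁≢π₂ ℓ⊆π₁ ℓ⊆π₂ Q∈π₁ Q∈π₂)
    where
    Q∈π₁ : PointOnPlane Q π₁
    Q∈π₁ = non-opposite⇒on-plane maximal d∈M c₁∈M P∉τ h∦ℓ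
    Q∈π₂ : PointOnPlane Q π₂
    Q∈π₂ = non-opposite⇒on-plane maximal d∈M c₂∈M P∉τ h∦ℓ

  module _ {u v π} (ℓ-line : IsLine (u , v)) (π-plane : IsPlane π) (ℓ⊆π : LineInPlane (u , v) π) where
    open SpanPoints (IsLine⇒Pivots ℓ-line)

    two-points⇒weightLP≡1+q : TwoMembers (λ P → M (P , (u , v) , π)) → weightLP M (u , v) π ≡ suc q
    two-points⇒weightLP≡1+q (P₁ , P₂ , P₁≢P₂ , c₁∈M , c₂∈M) =
      trans (length-filtered _ spanPoints-unique (mk⇔ flag∈M flag∈M⇒P∈span)) length-spanPoints
      where
      flag∈M : ∀ {P} → P ∈ spanPoints → M (P , (u , v) , π) ≡ true
      flag∈M {P} P∈ with ∈spanPoints⇒point∈span P∈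
      ... | P-point , P∈ℓ = maximal-absorbs maximal (P-point , ℓ-line , π-plane , P∈ℓ , ℓ⊆π) λ (Q , h , τ) d∈M →
        [ Meet⇒¬Opposite {P} {_} {π} {Q} {_} {τ} , (λ Q∈π (_ , Q∉π , _) → Q∉π Q∈π) ]′
          (two-points⇒dominant P₁≢P₂ c₁∈M c₂∈M Q h τ d∈M)
      flag∈M⇒P∈span : ∀ {P} → M (P , (u , v) , π) ≡ true → P ∈ spanPoints
      flag∈M⇒P∈span c∈M with chambers _ c∈M
      ... | P-point , _ , _ , P∈ℓ , _ = point∈span⇒∈spanPoints P-point P∈ℓ

  module _ {P u v} (ℓ-line : IsLine (u , v)) (P-point : IsPoint P) (P∈ℓ : PointOnLine P (u , v)) where
    open LineGeometry F (IsLine⇒Pivots ℓ-line)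
    open SpanPoints σ-pivots

    two-planes⇒weightPL≡1+q : TwoMembers (λ π → M (P , (u , v) , π)) → weightPL M P (u , v) ≡ suc q
    two-planes⇒weightPL≡1+q (π₁ , π₂ , π₁≢π₂ , c₁∈M , c₂∈M) =
      trans (length-filtered _ spanPoints-unique (mk⇔ flag∈M flag∈M⇒π∈span)) length-spanPoints
      where
      flag∈M : ∀ {π} → π ∈ spanPoints → M (P , (u , v) , π) ≡ true
      flag∈M {π} π∈ with ∈spanPoints⇒point∈span π∈
      ... | π-plane , π∈pencil = maximal-absorbs maximal
        (P-point , ℓ-line , π-plane , P∈ℓ , onPencil⇒inPlane π∈pencil) λ (Q , h , τ) d∈M →
        [ Meet⇒¬Opposite {P} {_} {π} {Q} {_} {τ} , (λ P∈τ (P∉τ , _ , _) → P∉τ P∈τ) ]′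
          (two-planes⇒dominant π₁≢π₂ c₁∈M c₂∈M Q h τ d∈M)
      flag∈M⇒π∈span : ∀ {π} → M (P , (u , v) , π) ≡ true → π ∈ spanPoints
      flag∈M⇒π∈span c∈M with chambers _ c∈M
      ... | _ , _ , π-plane , _ , ℓ⊆π = point∈span⇒∈spanPoints π-plane (inPlane⇒onPencil ℓ⊆π)

lemma2p1 : (F : FiniteField) → (M : PG3.Triple F → Bool) → PG3.MaximalIndependent F M →
    ((ℓ : PG3.Line F) (π : PG3.V4 F) → PG3.IsLine F ℓ → PG3.IsPlane F π → PG3.LineInPlane F ℓ π →
      ((PG3.weightLP F M ℓ π ≡ 0) ⊎ (PG3.weightLP F M ℓ π ≡ 1) ⊎ (PG3.weightLP F M ℓ π ≡ suc (FiniteField.q F)))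
      × (PG3.weightLP F M ℓ π ≡ suc (FiniteField.q F) →
          ∀ Q h τ → M (Q , h , τ) ≡ true → PG3.Meet F h ℓ ⊎ PG3.PointOnPlane F Q π))
    × ((P : PG3.V4 F) (ℓ : PG3.Line F) → PG3.IsPoint F P → PG3.IsLine F ℓ → PG3.PointOnLine F P ℓ →
      ((PG3.weightPL F M P ℓ ≡ 0) ⊎ (PG3.weightPL F M P ℓ ≡ 1) ⊎ (PG3.weightPL F M P ℓ ≡ suc (FiniteField.q F)))
      × (PG3.weightPL F M P ℓ ≡ suc (FiniteField.q F) →
          ∀ Q h τ → M (Q , h , τ) ≡ true → PG3.Meet F h ℓ ⊎ PG3.PointOnPlane F P τ))
lemma2p1 F M maximal =
  (λ { (u , v) π ℓ-line π-plane ℓ⊆π →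
       weight-trichotomy (λ P → M (P , (u , v) , π)) (two-points⇒weightLP≡1+q ℓ-line π-plane ℓ⊆π) ,
       λ weight≡1+q → let (_ , _ , P₁≢P₂ , c₁∈M , c₂∈M) = weight≡1+q⇒TwoMembers (λ P → M (P , (u , v) , π)) weight≡1+q
                      in two-points⇒dominant P₁≢P₂ c₁∈M c₂∈M }) ,
  (λ { P (u , v) P-point ℓ-line P∈ℓ →
       weight-trichotomy (λ π → M (P , (u , v) , π)) (two-planes⇒weightPL≡1+q ℓ-line P-point P∈ℓ) ,
       λ weight≡1+q → let (_ , _ , π₁≢π₂ , c₁∈M , c₂∈M) = weight≡1+q⇒TwoMembers (λ π → M (P , (u , v) , π)) weight≡1+q
                      in two-planes⇒dominant π₁≢π₂ c₁∈M c₂∈M })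
  where
  open Enumeration F
  open Dominance F maximal
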